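{- Let $R=R_1\times\cdots\times R_d$ with $d\ge 2$, where each $R_i$ is a finite commutative local ring, and assume $-1\in (R^{\times})^2$. Then $G_R(2)$ is prime if and only if all of the following hold: (1) there is at most one index $1\le i\le d$ with $R_i\cong\mathbb{F}_2$; (2) if $2$ is not invertible in $R_i$, then $R_i$ is a field of characteristic $2$; (3) if $2$ is invertible in $R_i$, then $R_i$ is a field of characteristic $\ell\neq 2$.
   Context: For a finite commutative ring $S$, $(S^{\times})^2=\{u^2:u\in S^{\times}\}$; it is assumed throughout that $-1$ lies in this set. $G_S(2)$ is the simple undirected graph with vertex set $S$ in which $a,b$ are adjacent iff $a-b\in (S^{\times})^2$. A homogeneous set in a graph $G$ is a set $X\subseteq V(G)$ such that every vertex outside $X$ is adjacent to all or none of the vertices of $X$; it is non-trivial if $2\le |X|<|V(G)|$. A graph is prime if it has no non-trivial homogeneous set. -}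

module Defs where

open import Level using (0ℓ) renaming (suc to lsuc)
open import Algebra.Bundles using (CommutativeRing)
open import Algebra.Structures
open import Algebra.Morphism.Structures using (module RingMorphisms)
open import Data.Bool.Base using (Bool; true; false)
open import Data.Bool.Properties using (xor-∧-commutativeRing)
open import Data.Nat.Base using (ℕ; zero; suc; _<_)
open import Data.Fin.Base using (Fin)
open import Data.Product using (Σ; ∃; _×_; _,_; proj₁; proj₂)
open import Data.Sum.Base using (_⊎_)
open import Relation.Nullary using (¬_)
open import Relation.Unary using (Pred; _⊆_)
open import Relation.Binary.Definitions using (Decidable)
open import Relation.Binary.PropositionalEquality using (_≡_; _≢_)

Ring₀ : Set₁
Ring₀ = CommutativeRing 0ℓ 0ℓ

module _ (R : Ring₀) where
  open CommutativeRing R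

  record IsFinite : Set where
    field
      size      : ℕ
      enum      : Fin size → Carrier
      enum-surj : ∀ x → ∃ λ i → enum i ≈ x
      enum-inj  : ∀ i j → enum i ≈ enum j → i ≡ j
      _≈?_      : Decidable _≈_

  IsUnit : Carrier → Set
  IsUnit x = ∃ λ y → x * y ≈ 1#

  SqUnit : Carrier → Set
  SqUnit x = ∃ λ u → IsUnit u × x ≈ u * u

  record IsIdeal (I : Pred Carrier 0ℓ) : Set where
    field
      resp  : ∀ {x y} → x ≈ y → I x → I y
      zero∈ : I 0#
      +-closed : ∀ {x y} → I x → I y → I (x + y)
      *-closed : ∀ r {x} → I x → I (r * x)

  record IsMaximalIdeal (M : Pred Carrier 0ℓ) : Set₁ where
    field
      isIdeal : IsIdeal M
      proper  : ¬ M 1#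
      maximal : ∀ J → IsIdeal J → M ⊆ J → ¬ J 1# → J ⊆ M

  IsLocal : Set₁
  IsLocal = Σ (Pred Carrier 0ℓ) λ M → IsMaximalIdeal M ×
              (∀ N → IsMaximalIdeal N → (N ⊆ M) × (M ⊆ N))

  IsField : Set
  IsField = (¬ 1# ≈ 0#) × (∀ x → ¬ x ≈ 0# → IsUnit x)

  natMul : ℕ → Carrier
  natMul zero    = 0#
  natMul (suc n) = 1# + natMul n

  HasCharacteristic : ℕ → Set
  HasCharacteristic n = (0 < n) × (natMul n ≈ 0#) ×
                        (∀ m → 0 < m → m < n → ¬ natMul m ≈ 0#)

  two : Carrier
  two = 1# + 1#

  -- The graph G_R(2): a ~ b  iff  a - b ∈ (R^×)^2
  Adj : Carrier → Carrier → Set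
  Adj a b = SqUnit (a - b)

  Subset : Set
  Subset = Σ (Carrier → Bool) λ X → ∀ {a b} → a ≈ b → X a ≡ X b

  _∈ₛ_ : Carrier → Subset → Set
  a ∈ₛ X = proj₁ X a ≡ true

  IsHomogeneous : Subset → Set
  IsHomogeneous X = ∀ v → ¬ (v ∈ₛ X) →
    (∀ x → x ∈ₛ X → Adj v x) ⊎ (∀ x → x ∈ₛ X → ¬ Adj v x)

  -- 2 ≤ |X| < |V|  (for finite vertex set): X has two distinct
  -- elements and X misses some vertex.
  IsNonTrivial : Subset → Set
  IsNonTrivial X = (∃ λ a → ∃ λ b → a ∈ₛ X × b ∈ₛ X × ¬ a ≈ b) ×
                   (∃ λ v → ¬ (v ∈ₛ X))

  IsPrimeGraph : Set
  IsPrimeGraph = ∀ X → IsHomogeneous X → ¬ IsNonTrivial X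

𝔽₂ : Ring₀
𝔽₂ = xor-∧-commutativeRing

_≅_ : Ring₀ → Ring₀ → Set
R ≅ S = ∃ λ (f : CommutativeRing.Carrier R → CommutativeRing.Carrier S) →
  RingMorphisms.IsRingIsomorphism (CommutativeRing.rawRing R)
                                  (CommutativeRing.rawRing S) f

module _ {d : ℕ} (R : Fin d → Ring₀) where
  private
    module R i = CommutativeRing (R i)
    C : Set
    C = (i : Fin d) → R.Carrier i
    _≈ₚ_ : C → C → Set
    x ≈ₚ y = ∀ i → R._≈_ i (x i) (y i)

  ΠRing : Ring₀
  ΠRing = record
    { Carrier = C
    ; _≈_ = _≈ₚ_
    ; _+_ = λ x y i → R._+_ i (x i) (y i)
    ; _*_ = λ x y i → R._*_ i (x i) (y i)
    ; -_  = λ x i → R.-_ i (x i)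
    ; 0#  = λ i → R.0# i
    ; 1#  = λ i → R.1# i
    ; isCommutativeRing = record
      { isRing = record
        { +-isAbelianGroup = record
          { isGroup = record
            { isMonoid = record
              { isSemigroup = record
                { isMagma = record
                  { isEquivalence = record
                    { refl = λ i → R.refl i
                    ; sym = λ p i → R.sym i (p i)
                    ; trans = λ p q i → R.trans i (p i) (q i) }
                  ; ∙-cong = λ p q i → R.+-cong i (p i) (q i) }
                ; assoc = λ x y z i → R.+-assoc i (x i) (y i) (z i) }
              ; identity = (λ x i → R.+-identityˡ i (x i))
                         , (λ x i → R.+-identityʳ i (x i)) }
            ; inverse = (λ x i → R.-‿inverseˡ i (x i))
                      , (λ x i → R.-‿inverseʳ i (x i))
            ; ⁻¹-cong = λ p i → R.-‿cong i (p i) }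
          ; comm = λ x y i → R.+-comm i (x i) (y i) }
        ; *-cong = λ p q i → R.*-cong i (p i) (q i)
        ; *-assoc = λ x y z i → R.*-assoc i (x i) (y i) (z i)
        ; *-identity = (λ x i → R.*-identityˡ i (x i))
                     , (λ x i → R.*-identityʳ i (x i))
        ; distrib = (λ x y z i → R.distribˡ i (x i) (y i) (z i))
                  , (λ x y z i → R.distribʳ i (x i) (y i) (z i)) }
      ; *-comm = λ x y i → R.*-comm i (x i) (y i) } }

{-# OPTIONS --safe #-}
-- Adjacency in G_R(2) is coordinatewise: x ~ y iff every xᵢ − yᵢ is a unit square of Rᵢ.
--
-- Necessity. Two factors Rᵢ ≅ Rⱼ ≅ 𝔽₂ make {x : xᵢ = xⱼ} a union of connected components, since
-- every edge flips both coordinates. If some Rᵢ is not a field, it contains a ≠ 0 with a² = 0 (the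
-- last nonzero iterated square of a nonzero non-unit, which is nilpotent). When 2 is a unit,
-- s ↦ s − a preserves unit squares, so 0 and a·eᵢ have the same neighbours. When 2 is not a unit,
-- the elements congruent to a square modulo 2Rᵢ contain 0 and are closed under adding unit squares,
-- but they are not all of Rᵢ: squaring modulo 2 kills a nonzero class, so it is not surjective on
-- the finite ring Rᵢ/2Rᵢ.
--
-- Sufficiency. Let every Rᵢ be a finite field in which −1 is a square. For c ≠ 0 some unit square s
-- has s − c not a unit square, so two distinct vertices of a homogeneous X yield an edge inside X;
-- using a second coordinate (d ≥ 2), X then contains every neighbour of a vertex of X that has a
-- neighbour in X. Two steps change the coordinates by arbitrary differences of unit squares, and in
-- a field with more than two elements every element is a sum of two such differences. An 𝔽₂-factor
-- is flipped by every edge, which one extra step takes care of; so X contains every vertex.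

module Submission where

open import Defs
open import Level using (0ℓ)
open import Algebra.Bundles using (CommutativeRing; RawRing)
open import Algebra.Morphism.Structures using (module RingMorphisms)
import Algebra.Properties.Ring as RingProperties
open import Algebra.Solver.Ring.AlmostCommutativeRing using (fromCommutativeRing; _-Raw-AlmostCommutative⟶_)
open import Data.Bool.Base using (Bool; true; false; not; _xor_; _∧_)
import Data.Bool.Properties as Bool
open import Data.Fin.Base as Fin using (Fin)
import Data.Fin.Properties as Fin
open import Data.Integer.Base as ℤ using (ℤ; +_; -[1+_])
import Data.Integer.Properties as ℤ
open import Data.List.Base as List using (List; []; _∷_)
open import Data.List.Membership.Propositional using (_∈_)
open import Data.List.Membership.Propositional.Properties using (∈-tabulate⁺)
open import Data.List.Relation.Unary.Any using (here; there)
open import Data.Maybe.Base using (Maybe; map)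
open import Data.Nat.Base as ℕ using (ℕ; zero; suc; _≤_)
open import Data.Nat.Induction using (<-rec)
import Data.Nat.Properties as ℕ
open import Data.Product as Σ using (∃; ∃₂; _×_; _,_; proj₁; proj₂)
open import Data.Sum as Sum using (_⊎_; inj₁; inj₂)
open import Function.Base using (_∘_; id; flip)
open import Function.Bundles using (_⇔_; mk⇔)
open import Relation.Binary.Bundles using (Setoid)
open import Relation.Binary.Consequences using (dec⇒weaklyDec)
open import Relation.Binary.Definitions using (_Respects_)
open import Relation.Binary.PropositionalEquality as ≡ using (_≡_; _≢_)
open import Relation.Nullary using (¬_; Dec; yes; no; contradiction)
open import Relation.Nullary.Decidable
  using (does; does-⇔; dec-true; dec-false; decidable-stable; map′; ¬?; _×-dec_; _⊎-dec_)
open import Relation.Unary as U using (Pred; _⊆_)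

module IntegerCoefficientSolver (R : Ring₀) where
  open CommutativeRing R
  open import Algebra.Properties.Ring ring using (-0#≈0#; -‿involutive; -‿distribˡ-*; -‿distribʳ-*)
  open import Algebra.Properties.AbelianGroup +-abelianGroup using (⁻¹-∙-comm)
  open import Algebra.Properties.CommutativeSemigroup +-commutativeSemigroup using (interchange)
  open import Algebra.Properties.Semiring.Mult.TCOptimised semiring using (×-homo-+; ×1-homo-*)
    renaming (_×_ to _·_)
  open import Relation.Binary.Reasoning.Setoid setoid

  private
    -- The optimised multiple makes ⟦ + 1 ⟧ and ⟦ + 2 ⟧ definitionally 1# and two R.
    ⟦_⟧ : ℤ → Carrier
    ⟦ + n ⟧      = n · 1#
    ⟦ -[1+ n ] ⟧ = - (suc n · 1#)

    -‿homo : ∀ i → ⟦ ℤ.- i ⟧ ≈ - ⟦ i ⟧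
    -‿homo (+ zero)  = sym -0#≈0#
    -‿homo (+ suc n) = refl
    -‿homo -[1+ n ]  = sym (-‿involutive _)

    ⊖-homo : ∀ m n → ⟦ m ℤ.⊖ n ⟧ ≈ m · 1# - n · 1#
    ⊖-homo m zero = begin
      ⟦ m ℤ.⊖ 0 ⟧        ≡⟨ ≡.cong ⟦_⟧ (ℤ.⊖-≥ {m} ℕ.z≤n) ⟩
      m · 1#             ≈⟨ +-identityʳ _ ⟨
      m · 1# + 0#        ≈⟨ +-congˡ -0#≈0# ⟨
      m · 1# - 0#        ∎
    ⊖-homo zero (suc n) = begin
      ⟦ 0 ℤ.⊖ suc n ⟧    ≡⟨ ≡.cong ⟦_⟧ (ℤ.⊖-< {0} {suc n} ℕ.z<s) ⟩
      - (suc n · 1#)     ≈⟨ +-identityˡ _ ⟨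
      0# - suc n · 1#    ∎
    ⊖-homo (suc m) (suc n) = begin
      ⟦ suc m ℤ.⊖ suc n ⟧                     ≡⟨ ≡.cong ⟦_⟧ (ℤ.[1+m]⊖[1+n]≡m⊖n m n) ⟩
      ⟦ m ℤ.⊖ n ⟧                             ≈⟨ ⊖-homo m n ⟩
      m · 1# - n · 1#                         ≈⟨ +-identityˡ _ ⟨
      0# + (m · 1# - n · 1#)                  ≈⟨ +-congʳ (-‿inverseʳ 1#) ⟨
      (1# - 1#) + (m · 1# - n · 1#)           ≈⟨ interchange _ _ _ _ ⟩
      (1# + m · 1#) + (- 1# - n · 1#)         ≈⟨ +-congˡ (⁻¹-∙-comm 1# _) ⟩
      (1# + m · 1#) - (1# + n · 1#)           ≈⟨ +-cong (×-homo-+ 1# 1 m) (-‿cong (×-homo-+ 1# 1 n)) ⟨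
      suc m · 1# - suc n · 1#                 ∎

    +-homo : ∀ i j → ⟦ i ℤ.+ j ⟧ ≈ ⟦ i ⟧ + ⟦ j ⟧
    +-homo (+ m)     (+ n)     = ×-homo-+ 1# m n
    +-homo (+ m)     -[1+ n ]  = ⊖-homo m (suc n)
    +-homo -[1+ m ]  (+ n)     = trans (⊖-homo n (suc m)) (+-comm _ _)
    +-homo -[1+ m ]  -[1+ n ]  = begin
      - (suc (suc (m ℕ.+ n)) · 1#)            ≡⟨ ≡.cong (λ k → - (suc k · 1#)) (ℕ.+-suc m n) ⟨
      - ((suc m ℕ.+ suc n) · 1#)              ≈⟨ -‿cong (×-homo-+ 1# (suc m) (suc n)) ⟩
      - (suc m · 1# + suc n · 1#)             ≈⟨ ⁻¹-∙-comm _ _ ⟨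
      - (suc m · 1#) - suc n · 1#             ∎

    *-homo-+ : ∀ m j → ⟦ + m ℤ.* j ⟧ ≈ ⟦ + m ⟧ * ⟦ j ⟧
    *-homo-+ m (+ n)    = trans (reflexive (≡.cong ⟦_⟧ (≡.sym (ℤ.pos-* m n)))) (×1-homo-* m n)
    *-homo-+ m -[1+ n ] = begin
      ⟦ + m ℤ.* -[1+ n ] ⟧                    ≡⟨ ≡.cong ⟦_⟧ (ℤ.neg-distribʳ-* (+ m) (+ suc n)) ⟨
      ⟦ ℤ.- (+ m ℤ.* + suc n) ⟧               ≈⟨ -‿homo (+ m ℤ.* + suc n) ⟩
      - ⟦ + m ℤ.* + suc n ⟧                   ≈⟨ -‿cong (*-homo-+ m (+ suc n)) ⟩
      - (m · 1# * suc n · 1#)                 ≈⟨ -‿distribʳ-* _ _ ⟩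
      m · 1# * - (suc n · 1#)                 ∎

    *-homo : ∀ i j → ⟦ i ℤ.* j ⟧ ≈ ⟦ i ⟧ * ⟦ j ⟧
    *-homo (+ m)    j = *-homo-+ m j
    *-homo -[1+ m ] j = begin
      ⟦ -[1+ m ] ℤ.* j ⟧                      ≡⟨ ≡.cong ⟦_⟧ (ℤ.neg-distribˡ-* (+ suc m) j) ⟨
      ⟦ ℤ.- (+ suc m ℤ.* j) ⟧                 ≈⟨ -‿homo (+ suc m ℤ.* j) ⟩
      - ⟦ + suc m ℤ.* j ⟧                     ≈⟨ -‿cong (*-homo-+ (suc m) j) ⟩
      - (suc m · 1# * ⟦ j ⟧)                  ≈⟨ -‿distribˡ-* _ _ ⟩
      - (suc m · 1#) * ⟦ j ⟧                  ∎

    ℤ-rawRing : RawRing 0ℓ 0ℓ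
    ℤ-rawRing = record
      { Carrier = ℤ ; _≈_ = _≡_ ; _+_ = ℤ._+_ ; _*_ = ℤ._*_ ; -_ = ℤ.-_ ; 0# = + 0 ; 1# = + 1 }

    homomorphism : ℤ-rawRing -Raw-AlmostCommutative⟶ fromCommutativeRing R
    homomorphism = record
      { ⟦_⟧ = ⟦_⟧ ; +-homo = +-homo ; *-homo = *-homo ; -‿homo = -‿homo
      ; 0-homo = refl ; 1-homo = refl }

    _≟ᶜ_ : ∀ i j → Maybe (⟦ i ⟧ ≈ ⟦ j ⟧)
    i ≟ᶜ j = map (λ { ≡.refl → refl }) (dec⇒weaklyDec ℤ._≟_ i j)

  open import Algebra.Solver.Ring ℤ-rawRing (fromCommutativeRing R) homomorphism _≟ᶜ_ public

iterate : {A : Set} → (A → A) → ℕ → A → A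
iterate f zero    x = x
iterate f (suc n) x = iterate f n (f x)

iterate-+ : {A : Set} (f : A → A) (m n : ℕ) (x : A) →
            iterate f (m ℕ.+ n) x ≡ iterate f n (iterate f m x)
iterate-+ f zero    n x = ≡.refl
iterate-+ f (suc m) n x = iterate-+ f m n (f x)

iterate-sucʳ : {A : Set} (f : A → A) (n : ℕ) (x : A) →
               iterate f (suc n) x ≡ f (iterate f n x)
iterate-sucʳ f zero    x = ≡.refl
iterate-sucʳ f (suc n) x = iterate-sucʳ f n (f x)

module _ {P : ℕ → Set} (P? : U.Decidable P) where

  least : ∀ {m} → P m → ∃ λ n → P n × (∀ {k} → k ℕ.< n → ¬ P k)
  least {m} = <-rec (λ m → P m → ∃ λ n → P n × (∀ {k} → k ℕ.< n → ¬ P k)) below-or-here m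
    where
    below-or-here : ∀ m → (∀ {k} → k ℕ.< m → P k → ∃ λ n → P n × (∀ {k} → k ℕ.< n → ¬ P k)) →
                    P m → ∃ λ n → P n × (∀ {k} → k ℕ.< n → ¬ P k)
    below-or-here m rec pm with ℕ.anyUpTo? P? m
    ... | yes (k , k<m , pk) = rec k<m pk
    ... | no none            = m , pm , λ k<m pk → none (_ , k<m , pk)

  boundary : P 0 → ∀ {n} → ¬ P n → ∃ λ j → P j × ¬ P (suc j)
  boundary p0 {zero}  ¬p0 = contradiction p0 ¬p0
  boundary p0 {suc n} ¬pn with P? n
  ... | yes pn  = n , pn , ¬pn
  ... | no ¬pn′ = boundary p0 ¬pn′

does-true : ∀ {A : Set} (a? : Dec A) → does a? ≡ true → A
does-true (yes a) _ = a

module FiniteSetoid (S : Setoid 0ℓ 0ℓ) {n : ℕ} (index : Setoid.Carrier S → Fin n)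
                    (index-sound : ∀ {x y} → index x ≡ index y → Setoid._≈_ S x y) where
  open Setoid S
  open import Relation.Binary.Reasoning.Setoid S

  pigeonhole : (s : ℕ → Carrier) → ∃₂ λ a c → s a ≈ s (a ℕ.+ suc c)
  pigeonhole s with i , j , i<j , same ← Fin.pigeonhole (ℕ.n<1+n n) (index ∘ s ∘ Fin.toℕ) =
    Fin.toℕ i , c , trans (index-sound same)
                          (reflexive (≡.cong s (≡.sym (≡.trans (ℕ.+-suc (Fin.toℕ i) c) (ℕ.m+[n∸m]≡n i<j)))))
    where c = Fin.toℕ j ℕ.∸ suc (Fin.toℕ i)

  module _ {f : Carrier → Carrier} (f-cong : ∀ {x y} → x ≈ y → f x ≈ f y) where

    iterate-cong : ∀ k {x y} → x ≈ y → iterate f k x ≈ iterate f k y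
    iterate-cong zero    x≈y = x≈y
    iterate-cong (suc k) x≈y = iterate-cong k (f-cong x≈y)

    iterate-fixed : ∀ k {x} → f x ≈ x → iterate f k x ≈ x
    iterate-fixed zero    fx≈x = refl
    iterate-fixed (suc k) fx≈x = trans (iterate-cong k fx≈x) (iterate-fixed k fx≈x)

    injective⇒periodic : (∀ {x y} → f x ≈ f y → x ≈ y) →
                         ∀ x → ∃ λ c → iterate f (suc c) x ≈ x
    injective⇒periodic f-inj x with a , c , same ← pigeonhole (λ k → iterate f k x) =
      c , sym (cancel a (begin
        iterate f a x                        ≈⟨ same ⟩
        iterate f (a ℕ.+ suc c) x            ≡⟨ ≡.cong (λ k → iterate f k x) (ℕ.+-comm a (suc c)) ⟩
        iterate f (suc c ℕ.+ a) x            ≡⟨ iterate-+ f (suc c) a x ⟩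
        iterate f a (iterate f (suc c) x)    ∎))
      where
      cancel : ∀ k {x y} → iterate f k x ≈ iterate f k y → x ≈ y
      cancel zero    same = same
      cancel (suc k) same = f-inj (cancel k same)

    surjective⇒periodic : (∀ y → ∃ λ x → f x ≈ y) →
                          ∀ x → ∃ λ c → iterate f (suc c) x ≈ x
    surjective⇒periodic f-surj x = periodic (pigeonhole preimage)
      where
      preimage : ℕ → Carrier
      preimage zero    = x
      preimage (suc k) = proj₁ (f-surj (preimage k))

      orbit : ∀ k j → iterate f k (preimage (k ℕ.+ j)) ≈ preimage j
      orbit zero    j = refl
      orbit (suc k) j = trans (iterate-cong k (proj₂ (f-surj (preimage (k ℕ.+ j))))) (orbit k j)

      periodic : (∃₂ λ a c → preimage a ≈ preimage (a ℕ.+ suc c)) → ∃ λ c → iterate f (suc c) x ≈ x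
      periodic (a , c , same) = c , (begin
        iterate f (suc c) x                           ≈⟨ iterate-cong (suc c) x≈preimage ⟩
        iterate f (suc c) (preimage (suc c ℕ.+ 0))    ≈⟨ orbit (suc c) 0 ⟩
        x                                             ∎)
        where
        x≈preimage : x ≈ preimage (suc c ℕ.+ 0)
        x≈preimage = begin
          x                                    ≈⟨ orbit a 0 ⟨
          iterate f a (preimage (a ℕ.+ 0))     ≡⟨ ≡.cong (iterate f a ∘ preimage) (ℕ.+-identityʳ a) ⟩
          iterate f a (preimage a)             ≈⟨ iterate-cong a same ⟩
          iterate f a (preimage (a ℕ.+ suc c)) ≈⟨ orbit a (suc c) ⟩
          preimage (suc c)                     ≡⟨ ≡.cong preimage (ℕ.+-identityʳ (suc c)) ⟨
          preimage (suc c ℕ.+ 0)               ∎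

SqDiff : (R : Ring₀) → CommutativeRing.Carrier R → Set
SqDiff R y = ∃₂ λ s s′ → SqUnit R s × SqUnit R s′ × y ≈ s - s′
  where open CommutativeRing R

SqDiff₂ : (R : Ring₀) → CommutativeRing.Carrier R → Set
SqDiff₂ R y = ∃₂ λ p q → SqDiff R p × SqDiff R q × y ≈ p + q
  where open CommutativeRing R

module UnitsAndSquares (R : Ring₀) where
  open CommutativeRing R
  open import Algebra.Properties.Ring ring using (-‿involutive)
  open import Relation.Binary.Reasoning.Setoid setoid
  open IntegerCoefficientSolver R

  square : Carrier → Carrier
  square x = x * x

  unit-resp : ∀ {x y} → x ≈ y → IsUnit R x → IsUnit R y
  unit-resp x≈y (x⁻¹ , inv) = x⁻¹ , trans (*-congʳ (sym x≈y)) inv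

  unit-1 : IsUnit R 1#
  unit-1 = 1# , *-identityˡ 1#

  unit-* : ∀ {x y} → IsUnit R x → IsUnit R y → IsUnit R (x * y)
  unit-* {x} {y} (x⁻¹ , x-inv) (y⁻¹ , y-inv) = x⁻¹ * y⁻¹ , (begin
    x * y * (x⁻¹ * y⁻¹)   ≈⟨ solve 4 (λ x y a b → x :* y :* (a :* b) := (x :* a) :* (y :* b)) refl x y x⁻¹ y⁻¹ ⟩
    x * x⁻¹ * (y * y⁻¹)   ≈⟨ *-cong x-inv y-inv ⟩
    1# * 1#               ≈⟨ *-identityˡ 1# ⟩
    1#                    ∎)

  unit-factorˡ : ∀ {x y} → IsUnit R (x * y) → IsUnit R x
  unit-factorˡ {x} {y} (z , inv) = y * z , trans (sym (*-assoc x y z)) inv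

  unit-factorʳ : ∀ {x y} → IsUnit R (x * y) → IsUnit R y
  unit-factorʳ {x} {y} u = unit-factorˡ (unit-resp (*-comm x y) u)

  unit-neg : ∀ {x} → IsUnit R x → IsUnit R (- x)
  unit-neg {x} (x⁻¹ , inv) = - x⁻¹ , trans (solve 2 (λ x a → :- x :* :- a := x :* a) refl x x⁻¹) inv

  unit-neg⁻ : ∀ {x} → IsUnit R (- x) → IsUnit R x
  unit-neg⁻ {x} u = unit-resp (-‿involutive x) (unit-neg u)

  ¬unit-0 : ¬ 1# ≈ 0# → ¬ IsUnit R 0#
  ¬unit-0 1≉0 (z , inv) = 1≉0 (trans (sym inv) (zeroˡ z))

  unit-cancel : ∀ {x y} → IsUnit R x → x * y ≈ 0# → y ≈ 0#
  unit-cancel {x} {y} (x⁻¹ , inv) xy≈0 = begin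
    y                ≈⟨ solve 3 (λ x a y → y := a :* (x :* y) :+ (con (+ 1) :- x :* a) :* y) refl x x⁻¹ y ⟩
    x⁻¹ * (x * y) + (1# - x * x⁻¹) * y
                     ≈⟨ +-cong (*-congˡ xy≈0) (*-congʳ (+-congˡ (-‿cong inv))) ⟩
    x⁻¹ * 0# + (1# - 1#) * y
                     ≈⟨ solve 2 (λ a y → a :* con (+ 0) :+ (con (+ 1) :- con (+ 1)) :* y := con (+ 0)) refl x⁻¹ y ⟩
    0#               ∎

  unit-1+nilsquare : ∀ {x} → x * x ≈ 0# → IsUnit R (1# + x)
  unit-1+nilsquare {x} xx≈0 = 1# - x , (begin
    (1# + x) * (1# - x)  ≈⟨ solve 1 (λ x → (con (+ 1) :+ x) :* (con (+ 1) :- x) := con (+ 1) :- x :* x) refl x ⟩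
    1# - x * x           ≈⟨ +-congˡ (-‿cong xx≈0) ⟩
    1# - 0#              ≈⟨ solve 0 (con (+ 1) :- con (+ 0) := con (+ 1)) refl ⟩
    1#                   ∎)

  square-resp : ∀ {x y} → x ≈ y → SqUnit R x → SqUnit R y
  square-resp x≈y (u , unit , x≈uu) = u , unit , trans (sym x≈y) x≈uu

  square⇒unit : ∀ {x} → SqUnit R x → IsUnit R x
  square⇒unit (u , unit , x≈uu) = unit-resp (sym x≈uu) (unit-* unit unit)

  square-of-unit : ∀ {u} → IsUnit R u → SqUnit R (u * u)
  square-of-unit unit = _ , unit , refl

  square-1 : SqUnit R 1#
  square-1 = square-resp (*-identityˡ 1#) (square-of-unit unit-1)

  square-* : ∀ {x y} → SqUnit R x → SqUnit R y → SqUnit R (x * y)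
  square-* {x} {y} (u , u-unit , x≈uu) (v , v-unit , y≈vv) = u * v , unit-* u-unit v-unit , (begin
    x * y              ≈⟨ *-cong x≈uu y≈vv ⟩
    u * u * (v * v)    ≈⟨ solve 2 (λ u v → u :* u :* (v :* v) := u :* v :* (u :* v)) refl u v ⟩
    u * v * (u * v)    ∎)

  square-neg : SqUnit R (- 1#) → ∀ {x} → SqUnit R x → SqUnit R (- x)
  square-neg sq-1 {x} sq-x = square-resp (solve 1 (λ x → :- con (+ 1) :* x := :- x) refl x) (square-* sq-1 sq-x)

  ¬square-0 : ¬ 1# ≈ 0# → ¬ SqUnit R 0#
  ¬square-0 1≉0 = ¬unit-0 1≉0 ∘ square⇒unit

  square-sub-nilsquare : IsUnit R (two R) → ∀ {a s} → a * a ≈ 0# → SqUnit R s → SqUnit R (s - a)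
  square-sub-nilsquare (h , 2h≈1) {a} {s} aa≈0 (w , (w′ , ww′≈1) , s≈ww) =
    w * e , unit-* (w′ , ww′≈1) e-unit , sym (begin
      w * e * (w * e)
        ≈⟨ solve 4 (λ w w′ h a → w :* (con (+ 1) :- a :* (w′ :* w′ :* h)) :* (w :* (con (+ 1) :- a :* (w′ :* w′ :* h)))
                              := w :* w :- a :* (w :* w′ :* (w :* w′) :* (con (+ 2) :* h))
                                 :+ a :* a :* (w :* (w′ :* w′ :* h) :* (w :* (w′ :* w′ :* h)))) refl w w′ h a ⟩
      w * w - a * (w * w′ * (w * w′) * (two R * h)) + a * a * (w * t * (w * t))
        ≈⟨ +-cong (+-congˡ (-‿cong (*-congˡ (*-cong (*-cong ww′≈1 ww′≈1) 2h≈1)))) (*-congʳ aa≈0) ⟩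
      w * w - a * (1# * 1# * 1#) + 0# * (w * t * (w * t))
        ≈⟨ solve 3 (λ w a z → w :* w :- a :* (con (+ 1) :* con (+ 1) :* con (+ 1)) :+ con (+ 0) :* z := w :* w :- a)
                   refl w a (w * t * (w * t)) ⟩
      w * w - a
        ≈⟨ +-congʳ s≈ww ⟨
      s - a ∎)
    where
    t = w′ * w′ * h
    e = 1# - a * t

    e-unit : IsUnit R e
    e-unit = unit-1+nilsquare (begin
      - (a * t) * - (a * t)  ≈⟨ solve 2 (λ a t → :- (a :* t) :* :- (a :* t) := a :* a :* (t :* t)) refl a t ⟩
      a * a * (t * t)        ≈⟨ *-congʳ aa≈0 ⟩
      0# * (t * t)           ≈⟨ zeroˡ _ ⟩
      0#                     ∎)

  square-add-nilsquare : IsUnit R (two R) → ∀ {a s} → a * a ≈ 0# → SqUnit R (s - a) → SqUnit R s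
  square-add-nilsquare unit-2 {a} {s} aa≈0 sq =
    square-resp (solve 2 (λ s a → s :- a :- :- a := s) refl s a)
                (square-sub-nilsquare unit-2 (trans (solve 1 (λ a → :- a :* :- a := a :* a) refl a) aa≈0) sq)

  sqDiff-0 : SqDiff R 0#
  sqDiff-0 = 1# , 1# , square-1 , square-1 , sym (-‿inverseʳ 1#)

  sqDiff₂-resp : SqDiff₂ R Respects _≈_
  sqDiff₂-resp x≈y (p , q , dp , dq , x≈p+q) = p , q , dp , dq , trans (sym x≈y) x≈p+q

  sqDiff⇒sqDiff₂ : ∀ {y} → SqDiff R y → SqDiff₂ R y
  sqDiff⇒sqDiff₂ {y} dy = y , 0# , dy , sqDiff-0 , sym (+-identityʳ y)

module FiniteRing (R : Ring₀) (finite : IsFinite R) where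
  open CommutativeRing R
  open IsFinite finite public using (_≈?_)
  open IsFinite finite using (size; enum; enum-surj)

  index : Carrier → Fin size
  index x = proj₁ (enum-surj x)

  enum-index : ∀ x → enum (index x) ≈ x
  enum-index x = proj₂ (enum-surj x)

  index-sound : ∀ {x y} → index x ≡ index y → x ≈ y
  index-sound {x} {y} same = trans (sym (enum-index x)) (trans (reflexive (≡.cong enum same)) (enum-index y))

  elements : List Carrier
  elements = List.tabulate enum

  ∈-elements : ∀ x → ∃ λ y → y ∈ elements × y ≈ x
  ∈-elements x = enum (index x) , ∈-tabulate⁺ (index x) , enum-index x

  module _ {Q : Carrier → Set} (Q-resp : Q Respects _≈_) (Q? : U.Decidable Q) where

    any? : Dec (∃ Q)
    any? = map′ (λ (i , q) → enum i , q) (λ (x , q) → index x , Q-resp (sym (enum-index x)) q)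
                (Fin.any? (Q? ∘ enum))

    ∀-enum⇒∀ : (∀ i → Q (enum i)) → ∀ x → Q x
    ∀-enum⇒∀ q x = Q-resp (enum-index x) (q (index x))

    all? : Dec (∀ x → Q x)
    all? = map′ ∀-enum⇒∀ (λ q → q ∘ enum) (Fin.all? (Q? ∘ enum))

    ¬∀⇒∃¬ : ¬ (∀ x → Q x) → ∃ λ x → ¬ Q x
    ¬∀⇒∃¬ ¬all = Σ.map enum id (Fin.¬∀⟶∃¬ size (Q ∘ enum) (Q? ∘ enum) (¬all ∘ ∀-enum⇒∀))

  unit? : U.Decidable (IsUnit R)
  unit? x = any? (λ y≈z xy≈1 → trans (*-congˡ (sym y≈z)) xy≈1) (λ y → (x * y) ≈? 1#)

  square? : U.Decidable (SqUnit R)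
  square? x = any? (λ u≈v (unit , x≈uu) → UnitsAndSquares.unit-resp R u≈v unit , trans x≈uu (*-cong u≈v u≈v))
                   (λ u → unit? u ×-dec (x ≈? (u * u)))

module FiniteRingIdeals (R : Ring₀) (finite : IsFinite R) where
  open CommutativeRing R
  open IntegerCoefficientSolver R
  open FiniteRing R finite

  record DecIdeal : Set₁ where
    field
      member   : Pred Carrier 0ℓ
      member?  : U.Decidable member
      isIdeal  : IsIdeal R member
    open IsIdeal isIdeal public
  open DecIdeal

  principal : Carrier → DecIdeal
  principal z = record
    { member  = λ x → ∃ λ r → x ≈ r * z
    ; member? = λ x → any? (λ r≈s x≈rz → trans x≈rz (*-congʳ r≈s)) (λ r → x ≈? (r * z))
    ; isIdeal = record
      { resp     = λ x≈y (r , x≈rz) → r , trans (sym x≈y) x≈rz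
      ; zero∈    = 0# , sym (zeroˡ z)
      ; +-closed = λ (r , x≈rz) (s , y≈sz) → r + s , trans (+-cong x≈rz y≈sz) (sym (distribʳ z r s))
      ; *-closed = λ t (r , x≈rz) → t * r , trans (*-congˡ x≈rz) (sym (*-assoc t r z))
      } }

  join : DecIdeal → Carrier → DecIdeal
  join I y = record
    { member  = λ x → ∃ λ r → member I (x - r * y)
    ; member? = λ x → any? (λ r≈s → resp I (+-congˡ (-‿cong (*-congʳ r≈s)))) (λ r → member? I (x - r * y))
    ; isIdeal = record
      { resp     = λ x≈x′ (r , m) → r , resp I (+-congʳ x≈x′) m
      ; zero∈    = 0# , resp I (solve 1 (λ y → con (+ 0) := con (+ 0) :- con (+ 0) :* y) refl y) (zero∈ I)
      ; +-closed = λ {x} {x′} (r , m) (r′ , m′) → r + r′ , resp I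
          (solve 5 (λ x x′ r r′ y → (x :- r :* y) :+ (x′ :- r′ :* y) := (x :+ x′) :- (r :+ r′) :* y) refl x x′ r r′ y)
          (+-closed I m m′)
      ; *-closed = λ t {x} (r , m) → t * r , resp I
          (solve 4 (λ t x r y → t :* (x :- r :* y) := t :* x :- (t :* r) :* y) refl t x r y)
          (*-closed I t m)
      } }

  ⊆-join : ∀ I y → member I ⊆ member (join I y)
  ⊆-join I y {x} m = 0# , resp I (solve 2 (λ x y → x := x :- con (+ 0) :* y) refl x y) m

  ∈-join : ∀ I y → member (join I y) y
  ∈-join I y = 1# , resp I (solve 1 (λ y → con (+ 0) := y :- con (+ 1) :* y) refl y) (zero∈ I)

  join-⊆ : ∀ I y {J} → IsIdeal R J → member I ⊆ J → J y → member (join I y) ⊆ J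
  join-⊆ I y J-ideal I⊆J y∈J {x} (r , m) = J.resp (solve 3 (λ x r y → (x :- r :* y) :+ r :* y := x) refl x r y)
                                                   (J.+-closed (I⊆J m) (J.*-closed r y∈J))
    where module J = IsIdeal J-ideal

  -- Zorn's lemma for a finite ring: scan all elements, adjoining each one that keeps the ideal proper.
  extend : DecIdeal → Carrier → DecIdeal
  extend I y with member? (join I y) 1#
  ... | yes _ = I
  ... | no  _ = join I y

  ⊆-extend : ∀ I y → member I ⊆ member (extend I y)
  ⊆-extend I y with member? (join I y) 1#
  ... | yes _ = id
  ... | no  _ = ⊆-join I y

  extend-proper : ∀ I y → ¬ member I 1# → ¬ member (extend I y) 1#
  extend-proper I y ¬1∈I with member? (join I y) 1#
  ... | yes _     = ¬1∈I
  ... | no ¬1∈I+y = ¬1∈I+y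

  extend-absorbs : ∀ I y {J} → IsIdeal R J → member (extend I y) ⊆ J → ¬ J 1# → J y → member (extend I y) y
  extend-absorbs I y J-ideal ext⊆J ¬1∈J y∈J with member? (join I y) 1#
  ... | yes 1∈I+y = contradiction (join-⊆ I y J-ideal ext⊆J y∈J 1∈I+y) ¬1∈J
  ... | no  _     = ∈-join I y

  saturate : DecIdeal → List Carrier → DecIdeal
  saturate = List.foldl extend

  ⊆-saturate : ∀ I ys → member I ⊆ member (saturate I ys)
  ⊆-saturate I []       = id
  ⊆-saturate I (y ∷ ys) = ⊆-saturate (extend I y) ys ∘ ⊆-extend I y

  saturate-proper : ∀ I ys → ¬ member I 1# → ¬ member (saturate I ys) 1#
  saturate-proper I []       = id
  saturate-proper I (y ∷ ys) = saturate-proper (extend I y) ys ∘ extend-proper I y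

  saturate-absorbs : ∀ I ys {J} → IsIdeal R J → member (saturate I ys) ⊆ J → ¬ J 1# →
                     ∀ {y} → y ∈ ys → J y → member (saturate I ys) y
  saturate-absorbs I (y ∷ ys) J-ideal sat⊆J ¬1∈J (here ≡.refl) y∈J =
    ⊆-saturate (extend I y) ys
      (extend-absorbs I y J-ideal (sat⊆J ∘ ⊆-saturate (extend I y) ys) ¬1∈J y∈J)
  saturate-absorbs I (y ∷ ys) J-ideal sat⊆J ¬1∈J (there y∈ys) =
    saturate-absorbs (extend I y) ys J-ideal sat⊆J ¬1∈J y∈ys

  maximal-⊇ : ∀ I → ¬ member I 1# → ∃ λ N → IsMaximalIdeal R N × member I ⊆ N
  maximal-⊇ I ¬1∈I = member N , N-maximal , ⊆-saturate I elements
    where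
    N = saturate I elements
    N-maximal : IsMaximalIdeal R (member N)
    N-maximal = record
      { isIdeal = isIdeal N
      ; proper  = saturate-proper I elements ¬1∈I
      ; maximal = λ J J-ideal N⊆J ¬1∈J {x} x∈J →
          let (y , y∈elements , y≈x) = ∈-elements x
          in resp N y≈x (saturate-absorbs I elements J-ideal N⊆J ¬1∈J y∈elements
                                          (IsIdeal.resp J-ideal (sym y≈x) x∈J))
      }

module FiniteLocalRing (R : Ring₀) (finite : IsFinite R) (local : IsLocal R) where
  open CommutativeRing R
  open import Relation.Binary.Reasoning.Setoid setoid
  open IntegerCoefficientSolver R
  open UnitsAndSquares R
  open FiniteRing R finite
  open FiniteRingIdeals R finite
  open DecIdeal using (member)

  M : Pred Carrier 0ℓ
  M = proj₁ local

  private
    M-maximal = proj₁ (proj₂ local)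
    module M = IsIdeal (IsMaximalIdeal.isIdeal M-maximal)

  principal-proper : ∀ {x} → ¬ IsUnit R x → ¬ member (principal x) 1#
  principal-proper {x} ¬unit (r , 1≈rx) = ¬unit (r , trans (*-comm x r) (sym 1≈rx))

  nonunit⇒∈M : ∀ {x} → ¬ IsUnit R x → M x
  nonunit⇒∈M {x} ¬unit with N , N-maximal , ⟨x⟩⊆N ← maximal-⊇ (principal x) (principal-proper ¬unit) =
    proj₁ (proj₂ (proj₂ local) N N-maximal) (⟨x⟩⊆N (1# , sym (*-identityˡ x)))

  ∈M⇒nonunit : ∀ {x} → M x → ¬ IsUnit R x
  ∈M⇒nonunit {x} x∈M (y , xy≈1) = IsMaximalIdeal.proper M-maximal (M.resp (trans (*-comm y x) xy≈1) (M.*-closed y x∈M))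

  1≉0 : ¬ 1# ≈ 0#
  1≉0 1≈0 = IsMaximalIdeal.proper M-maximal (M.resp (sym 1≈0) M.zero∈)

  nonunit-+ : ∀ {x y} → ¬ IsUnit R x → ¬ IsUnit R y → ¬ IsUnit R (x + y)
  nonunit-+ ¬unit-x ¬unit-y = ∈M⇒nonunit (M.+-closed (nonunit⇒∈M ¬unit-x) (nonunit⇒∈M ¬unit-y))

  unit-1+nonunit : ∀ {m} → ¬ IsUnit R m → IsUnit R (1# + m)
  unit-1+nonunit {m} ¬unit = decidable-stable (unit? _) λ ¬unit-1+m →
    nonunit-+ ¬unit-1+m (¬unit ∘ unit-neg⁻) (unit-resp (solve 1 (λ m → con (+ 1) := (con (+ 1) :+ m) :- m) refl m) unit-1)

  absorbs-nonunit⇒0 : ∀ {t m} → ¬ IsUnit R m → t ≈ t * m → t ≈ 0#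
  absorbs-nonunit⇒0 {t} {m} ¬unit t≈tm = unit-cancel (unit-1+nonunit (¬unit ∘ unit-neg⁻)) (begin
    (1# + - m) * t  ≈⟨ solve 2 (λ t m → (con (+ 1) :- m) :* t := t :- t :* m) refl t m ⟩
    t - t * m       ≈⟨ +-congˡ (-‿cong (sym t≈tm)) ⟩
    t - t           ≈⟨ -‿inverseʳ t ⟩
    0#              ∎)

  nonunit-iterate-square : ∀ k {x} → ¬ IsUnit R x → ¬ IsUnit R (iterate square k x)
  nonunit-iterate-square zero    ¬unit = ¬unit
  nonunit-iterate-square (suc k) ¬unit = nonunit-iterate-square k (¬unit ∘ unit-factorˡ)

  iterate-square-multiple : ∀ k t → ∃ λ g → iterate square (suc k) t ≈ t * (t * g)
  iterate-square-multiple zero    t = 1# , solve 1 (λ t → t :* t := t :* (t :* con (+ 1))) refl t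
  iterate-square-multiple (suc k) t with g , eq ← iterate-square-multiple k (t * t) =
    t * t * g , trans eq (solve 2 (λ t g → t :* t :* (t :* t :* g) := t :* (t :* (t :* t :* g))) refl t g)

  open FiniteSetoid setoid index index-sound using (pigeonhole)

  iterate-square-vanishes : ∀ {x} → ¬ IsUnit R x → ∃ λ a → iterate square a x ≈ 0#
  iterate-square-vanishes {x} ¬unit with a , c , same ← pigeonhole (λ k → iterate square k x) =
    a , absorbs-nonunit⇒0 (nonunit-iterate-square a ¬unit ∘ unit-factorˡ) (begin
      t                                    ≈⟨ same ⟩
      iterate square (a ℕ.+ suc c) x       ≡⟨ iterate-+ square a (suc c) x ⟩
      iterate square (suc c) t             ≈⟨ proj₂ (iterate-square-multiple c t) ⟩
      t * (t * proj₁ (iterate-square-multiple c t)) ∎)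
    where t = iterate square a x

  nilsquare : ∀ {x} → ¬ IsUnit R x → ¬ x ≈ 0# → ∃ λ a → ¬ a ≈ 0# × a * a ≈ 0#
  nilsquare {x} ¬unit x≉0 = last-nonzero (boundary nonzero? x≉0 {proj₁ vanishes} (λ ≉0 → ≉0 (proj₂ vanishes)))
    where
    s : ℕ → Carrier
    s k = iterate square k x

    vanishes : ∃ λ a → s a ≈ 0#
    vanishes = iterate-square-vanishes ¬unit

    nonzero? : U.Decidable (λ k → ¬ s k ≈ 0#)
    nonzero? k = ¬? (s k ≈? 0#)

    last-nonzero : (∃ λ j → ¬ s j ≈ 0# × ¬ ¬ s (suc j) ≈ 0#) → ∃ λ a → ¬ a ≈ 0# × a * a ≈ 0#
    last-nonzero (j , ≉0 , ¬≉0) =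
      s j , ≉0 , trans (reflexive (≡.sym (iterate-sucʳ square j x))) (decidable-stable (s (suc j) ≈? 0#) ¬≉0)

module CongruenceModTwo (R : Ring₀) where
  open CommutativeRing R
  open import Relation.Binary.Reasoning.Setoid setoid
  open IntegerCoefficientSolver R
  open UnitsAndSquares R using (square)

  infix 4 _≡₂_
  _≡₂_ : Carrier → Carrier → Set
  x ≡₂ y = ∃ λ w → x ≈ y + two R * w

  ≈⇒≡₂ : ∀ {x y} → x ≈ y → x ≡₂ y
  ≈⇒≡₂ {x} {y} x≈y = 0# , trans x≈y (solve 1 (λ y → y := y :+ con (+ 2) :* con (+ 0)) refl y)

  ≡₂-sym : ∀ {x y} → x ≡₂ y → y ≡₂ x
  ≡₂-sym {x} {y} (w , x≈y+2w) = - w , (begin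
    y                        ≈⟨ solve 2 (λ y w → y := y :+ con (+ 2) :* w :+ con (+ 2) :* :- w) refl y w ⟩
    y + two R * w + two R * - w ≈⟨ +-congʳ x≈y+2w ⟨
    x + two R * - w          ∎)

  ≡₂-trans : ∀ {x y z} → x ≡₂ y → y ≡₂ z → x ≡₂ z
  ≡₂-trans {x} {y} {z} (w , x≈y+2w) (w′ , y≈z+2w′) = w′ + w , (begin
    x                              ≈⟨ x≈y+2w ⟩
    y + two R * w                  ≈⟨ +-congʳ y≈z+2w′ ⟩
    z + two R * w′ + two R * w
      ≈⟨ solve 3 (λ z w w′ → z :+ con (+ 2) :* w′ :+ con (+ 2) :* w := z :+ con (+ 2) :* (w′ :+ w)) refl z w w′ ⟩
    z + two R * (w′ + w)           ∎)

  ≡₂-setoid : Setoid 0ℓ 0ℓ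
  ≡₂-setoid = record
    { Carrier = Carrier ; _≈_ = _≡₂_
    ; isEquivalence = record { refl = ≈⇒≡₂ refl ; sym = ≡₂-sym ; trans = ≡₂-trans } }

  square-cong₂ : ∀ {x y} → x ≡₂ y → square x ≡₂ square y
  square-cong₂ {x} {y} (w , x≈y+2w) = two R * y * w + two R * w * w , (begin
    x * x                              ≈⟨ *-cong x≈y+2w x≈y+2w ⟩
    (y + two R * w) * (y + two R * w)
      ≈⟨ solve 2 (λ y w → (y :+ con (+ 2) :* w) :* (y :+ con (+ 2) :* w)
                       := y :* y :+ con (+ 2) :* (con (+ 2) :* y :* w :+ con (+ 2) :* w :* w)) refl y w ⟩
    y * y + two R * (two R * y * w + two R * w * w) ∎)

  SquareMod₂ : Carrier → Set
  SquareMod₂ x = ∃ λ z → x ≡₂ z * z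

  squareMod₂-resp : SquareMod₂ Respects _≈_
  squareMod₂-resp x≈y (z , x≡zz) = z , ≡₂-trans (≈⇒≡₂ (sym x≈y)) x≡zz

  squareMod₂-0 : SquareMod₂ 0#
  squareMod₂-0 = 0# , ≈⇒≡₂ (sym (zeroˡ 0#))

  squareMod₂-+square : ∀ {x y} → SquareMod₂ x → SqUnit R (y - x) → SquareMod₂ y
  squareMod₂-+square {x} {y} (z , w , x≈zz+2w) (u , _ , y-x≈uu) = z + u , w - z * u , (begin
    y                                  ≈⟨ solve 2 (λ x y → y := y :- x :+ x) refl x y ⟩
    y - x + x                          ≈⟨ +-cong y-x≈uu x≈zz+2w ⟩
    u * u + (z * z + two R * w)
      ≈⟨ solve 3 (λ z u w → u :* u :+ (z :* z :+ con (+ 2) :* w)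
                         := (z :+ u) :* (z :+ u) :+ con (+ 2) :* (w :- z :* u)) refl z u w ⟩
    (z + u) * (z + u) + two R * (w - z * u) ∎)

module EvenFiniteLocalRing (R : Ring₀) (finite : IsFinite R) (local : IsLocal R)
                           (¬unit-2 : ¬ IsUnit R (two R)) where
  open CommutativeRing R
  open import Relation.Binary.Reasoning.Setoid setoid
  open IntegerCoefficientSolver R
  open UnitsAndSquares R
  open FiniteRing R finite
  open FiniteLocalRing R finite local
  open CongruenceModTwo R

  _≡₂?_ : ∀ x y → Dec (x ≡₂ y)
  x ≡₂? y = any? (λ w≈w′ x≈y+2w → trans x≈y+2w (+-congˡ (*-congˡ w≈w′))) (λ w → x ≈? (y + two R * w))

  squareMod₂? : U.Decidable SquareMod₂
  squareMod₂? x = any? (λ z≈z′ x≡zz → ≡₂-trans x≡zz (≈⇒≡₂ (*-cong z≈z′ z≈z′))) (λ z → x ≡₂? (z * z))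

  two≈0 : ∀ {u} → u * u ≈ - 1# → u + 1# ≡₂ 0# → two R ≈ 0#
  two≈0 {u} uu≈-1 (r , u+1≈2r) = unit-cancel (unit-1+nonunit (¬unit-2 ∘ unit-factorʳ)) (begin
    (1# + (r * r - r) * two R) * two R
      ≈⟨ solve 1 (λ r → (con (+ 1) :+ (r :* r :- r) :* con (+ 2)) :* con (+ 2)
                     := (con (+ 0) :+ con (+ 2) :* r) :* (con (+ 0) :+ con (+ 2) :* r)
                        :- con (+ 2) :* (con (+ 0) :+ con (+ 2) :* r) :+ con (+ 2)) refl r ⟩
    (0# + two R * r) * (0# + two R * r) - two R * (0# + two R * r) + two R
      ≈⟨ +-congʳ (+-cong (*-cong u+1≈2r u+1≈2r) (-‿cong (*-congˡ u+1≈2r))) ⟨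
    (u + 1#) * (u + 1#) - two R * (u + 1#) + two R
      ≈⟨ solve 1 (λ u → (u :+ con (+ 1)) :* (u :+ con (+ 1)) :- con (+ 2) :* (u :+ con (+ 1)) :+ con (+ 2)
                     := u :* u :+ con (+ 1)) refl u ⟩
    u * u + 1#   ≈⟨ +-congʳ uu≈-1 ⟩
    - 1# + 1#    ≈⟨ -‿inverseˡ 1# ⟩
    0#           ∎)

  nilsquare-mod₂ : SqUnit R (- 1#) → ∀ {x} → ¬ IsUnit R x → ¬ x ≈ 0# → ∃ λ b → ¬ b ≡₂ 0# × square b ≡₂ 0#
  nilsquare-mod₂ (u , _ , -1≈uu) {x} ¬unit x≉0 = by-cases ((u + 1#) ≡₂? 0#)
    where
    by-cases : Dec (u + 1# ≡₂ 0#) → ∃ λ b → ¬ b ≡₂ 0# × square b ≡₂ 0#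
    by-cases (no u+1≢0) = u + 1# , u+1≢0 , u , (begin
      (u + 1#) * (u + 1#)        ≈⟨ solve 1 (λ u → (u :+ con (+ 1)) :* (u :+ con (+ 1)) := u :* u :+ con (+ 1) :+ con (+ 2) :* u) refl u ⟩
      u * u + 1# + two R * u     ≈⟨ +-congʳ (+-congʳ (sym -1≈uu)) ⟩
      - 1# + 1# + two R * u      ≈⟨ +-congʳ (-‿inverseˡ 1#) ⟩
      0# + two R * u             ∎)
    by-cases (yes u+1≡0) = nilsquare-is-nonzero-mod₂ (nilsquare ¬unit x≉0)
      where
      nilsquare-is-nonzero-mod₂ : (∃ λ a → ¬ a ≈ 0# × a * a ≈ 0#) → ∃ λ b → ¬ b ≡₂ 0# × square b ≡₂ 0#
      nilsquare-is-nonzero-mod₂ (a , a≉0 , aa≈0) = a , a≢0 , ≈⇒≡₂ aa≈0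
        where
        a≢0 : ¬ a ≡₂ 0#
        a≢0 (w , a≈2w) = a≉0 (begin
          a               ≈⟨ a≈2w ⟩
          0# + two R * w  ≈⟨ +-congˡ (*-congʳ (two≈0 (sym -1≈uu) u+1≡0)) ⟩
          0# + 0# * w     ≈⟨ solve 1 (λ w → con (+ 0) :+ con (+ 0) :* w := con (+ 0)) refl w ⟩
          0#              ∎)

  ¬all-squareMod₂ : SqUnit R (- 1#) → ∀ {x} → ¬ IsUnit R x → ¬ x ≈ 0# → ¬ (∀ y → SquareMod₂ y)
  ¬all-squareMod₂ sq-1 ¬unit x≉0 all = kernel-trivial (nilsquare-mod₂ sq-1 ¬unit x≉0)
    where
    open FiniteSetoid ≡₂-setoid index (≈⇒≡₂ ∘ index-sound)

    surjective : ∀ y → ∃ λ z → square z ≡₂ y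
    surjective y = proj₁ (all y) , ≡₂-sym (proj₂ (all y))

    kernel-trivial : ¬ (∃ λ b → ¬ b ≡₂ 0# × square b ≡₂ 0#)
    kernel-trivial (b , b≢0 , bb≡0) = b≢0 (vanishes (surjective⇒periodic square-cong₂ surjective b))
      where
      vanishes : (∃ λ c → iterate square (suc c) b ≡₂ b) → b ≡₂ 0#
      vanishes (c , cycle) = ≡₂-trans (≡₂-sym cycle) (≡₂-trans (iterate-cong square-cong₂ c bb≡0)
                                                                (iterate-fixed square-cong₂ c (≈⇒≡₂ (zeroˡ 0#))))

ZeroOrOne : Ring₀ → Set
ZeroOrOne R = ∀ y → y ≈ 0# ⊎ y ≈ 1#
  where open CommutativeRing R

module FiniteField (R : Ring₀) (finite : IsFinite R) (isField : IsField R)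
                   (sq-1 : SqUnit R (CommutativeRing.-_ R (CommutativeRing.1# R))) where
  open CommutativeRing R
  open import Algebra.Properties.Ring ring using (x∙y⁻¹≈ε⇒x≈y; x≈y⇒x∙y⁻¹≈ε; +-inverseˡ-unique)
  open import Relation.Binary.Reasoning.Setoid setoid
  open IntegerCoefficientSolver R
  open UnitsAndSquares R
  open FiniteRing R finite

  1≉0 : ¬ 1# ≈ 0#
  1≉0 = proj₁ isField

  nonzero⇒unit : ∀ {x} → ¬ x ≈ 0# → IsUnit R x
  nonzero⇒unit = proj₂ isField _

  nilsquare⇒0 : ∀ {x} → x * x ≈ 0# → x ≈ 0#
  nilsquare⇒0 {x} xx≈0 = decidable-stable (x ≈? 0#) λ x≉0 → x≉0 (unit-cancel (nonzero⇒unit x≉0) xx≈0)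

  square-injective : two R ≈ 0# → ∀ {x y} → x * x ≈ y * y → x ≈ y
  square-injective 2≈0 {x} {y} xx≈yy = x∙y⁻¹≈ε⇒x≈y x y (nilsquare⇒0 (begin
    (x - y) * (x - y)
      ≈⟨ solve 2 (λ x y → (x :- y) :* (x :- y) := x :* x :- y :* y :+ con (+ 2) :* (y :* y :- x :* y)) refl x y ⟩
    x * x - y * y + two R * (y * y - x * y)
      ≈⟨ +-cong (+-congʳ xx≈yy) (*-congʳ 2≈0) ⟩
    y * y - y * y + 0# * (y * y - x * y)
      ≈⟨ solve 2 (λ x y → y :* y :- y :* y :+ con (+ 0) :* (y :* y :- x :* y) := con (+ 0)) refl x y ⟩
    0# ∎))

  nonzero⇒square : two R ≈ 0# → ∀ {x} → ¬ x ≈ 0# → SqUnit R x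
  nonzero⇒square 2≈0 {x} x≉0 = root (injective⇒periodic (λ x≈y → *-cong x≈y x≈y) (square-injective 2≈0) x)
    where
    open FiniteSetoid setoid index index-sound using (injective⇒periodic)
    root : (∃ λ c → iterate square (suc c) x ≈ x) → SqUnit R x
    root (c , cycle) = y , nonzero⇒unit y≉0 , x≈yy
      where
      y = iterate square c x
      x≈yy : x ≈ y * y
      x≈yy = trans (sym cycle) (reflexive (iterate-sucʳ square c x))
      y≉0 : ¬ y ≈ 0#
      y≉0 y≈0 = x≉0 (trans x≈yy (trans (*-cong y≈0 y≈0) (zeroˡ 0#)))

  difference-of-squares : ∀ {h} → two R * h ≈ 1# → ∀ y → y ≈ (y + 1#) * h * ((y + 1#) * h) - (y - 1#) * h * ((y - 1#) * h)
  difference-of-squares {h} 2h≈1 y = begin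
    y                                   ≈⟨ solve 1 (λ y → y := y :* (con (+ 1) :* con (+ 1))) refl y ⟩
    y * (1# * 1#)                       ≈⟨ *-congˡ (*-cong 2h≈1 2h≈1) ⟨
    y * (two R * h * (two R * h))
      ≈⟨ solve 2 (λ y h → y :* (con (+ 2) :* h :* (con (+ 2) :* h))
                       := (y :+ con (+ 1)) :* h :* ((y :+ con (+ 1)) :* h) :- (y :- con (+ 1)) :* h :* ((y :- con (+ 1)) :* h))
                 refl y h ⟩
    (y + 1#) * h * ((y + 1#) * h) - (y - 1#) * h * ((y - 1#) * h) ∎

  Shift : Carrier → Set
  Shift u = ∀ {s} → SqUnit R s → SqUnit R (s + u)

  shift-resp : Shift Respects _≈_
  shift-resp u≈v shift-u sq = square-resp (+-congˡ u≈v) (shift-u sq)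

  shift-+ : ∀ {u v} → Shift u → Shift v → Shift (u + v)
  shift-+ {u} {v} shift-u shift-v {s} sq = square-resp (+-assoc s u v) (shift-v (shift-u sq))

  shift-scale : ∀ t {u} → Shift u → Shift (t * t * u)
  shift-scale t {u} shift-u {s} sq with t ≈? 0#
  ... | yes t≈0 = square-resp (begin
    s                 ≈⟨ solve 2 (λ s u → s := s :+ con (+ 0) :* con (+ 0) :* u) refl s u ⟩
    s + 0# * 0# * u   ≈⟨ +-congˡ (*-congʳ (*-cong t≈0 t≈0)) ⟨
    s + t * t * u     ∎) sq
  ... | no t≉0 with t′ , tt′≈1 ← nonzero⇒unit t≉0 =
    square-resp (begin
      t * t * (t′ * t′ * s + u)
        ≈⟨ solve 4 (λ t t′ s u → t :* t :* (t′ :* t′ :* s :+ u) := t :* t′ :* (t :* t′) :* s :+ t :* t :* u) refl t t′ s u ⟩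
      t * t′ * (t * t′) * s + t * t * u   ≈⟨ +-congʳ (*-congʳ (*-cong tt′≈1 tt′≈1)) ⟩
      1# * 1# * s + t * t * u             ≈⟨ +-congʳ (trans (*-congʳ (*-identityˡ 1#)) (*-identityˡ s)) ⟩
      s + t * t * u                       ∎)
    (square-* (square-of-unit (t′ , tt′≈1)) (shift-u (square-* (square-of-unit (t , trans (*-comm t′ t) tt′≈1)) sq)))

  ¬shift-neg : IsUnit R (two R) → ∀ {c} → ¬ c ≈ 0# → ¬ Shift (- c)
  ¬shift-neg (h , 2h≈1) {c} c≉0 shift-c = ¬square-0 1≉0 (square-resp (-‿inverseʳ 1#) (shift-1 square-1))
    where
    y = proj₁ (nonzero⇒unit c≉0)
    i = proj₁ sq-1
    A = (y + 1#) * h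
    B = (y - 1#) * h

    1+ii≈0 : 1# + i * i ≈ 0#
    1+ii≈0 = trans (+-congˡ (sym (proj₂ (proj₂ sq-1)))) (-‿inverseʳ 1#)

    -- c⁻¹ = A² − B² and i² = −1 give −1 = A²(−c) + (iB)²(−c); translation by −1 sends the square 1 to 0.
    shift-1 : Shift (- 1#)
    shift-1 = shift-resp (begin
      A * A * - c + i * B * (i * B) * - c
        ≈⟨ solve 4 (λ A B c i → A :* A :* :- c :+ i :* B :* (i :* B) :* :- c
                              := :- (c :* (A :* A :- B :* B)) :- c :* (con (+ 1) :+ i :* i) :* (B :* B)) refl A B c i ⟩
      - (c * (A * A - B * B)) - c * (1# + i * i) * (B * B)
        ≈⟨ +-cong (-‿cong (*-congˡ (difference-of-squares 2h≈1 y))) (-‿cong (*-congʳ (*-congˡ (sym 1+ii≈0)))) ⟨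
      - (c * y) - c * 0# * (B * B)
        ≈⟨ +-congʳ (-‿cong (proj₂ (nonzero⇒unit c≉0))) ⟩
      - 1# - c * 0# * (B * B)
        ≈⟨ solve 2 (λ c B → :- con (+ 1) :- c :* con (+ 0) :* (B :* B) := :- con (+ 1)) refl c B ⟩
      - 1# ∎) (shift-+ (shift-scale A shift-c) (shift-scale (i * B) shift-c))

  shifted-nonsquare : ∀ {c} → ¬ c ≈ 0# → ∃ λ s → SqUnit R s × ¬ SqUnit R (s - c)
  shifted-nonsquare {c} c≉0 with two R ≈? 0#
  ... | yes 2≈0 = c , nonzero⇒square 2≈0 c≉0 , ¬square-0 1≉0 ∘ square-resp (-‿inverseʳ c)
  ... | no  2≉0 = decidable-stable (any? resp (λ s → square? s ×-dec ¬? (square? (s - c)))) λ none →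
    ¬shift-neg (nonzero⇒unit 2≉0) c≉0 λ {s} sq → decidable-stable (square? (s - c)) (λ ¬sq → none (s , sq , ¬sq))
    where
    resp : (λ s → SqUnit R s × ¬ SqUnit R (s - c)) Respects _≈_
    resp s≈s′ (sq , ¬sq) = square-resp s≈s′ sq , ¬sq ∘ square-resp (+-congʳ (sym s≈s′))

  separating-square : ∀ {a b} → ¬ a ≈ b → ∃ λ s → SqUnit R s × ¬ SqUnit R (a + s - b)
  separating-square {a} {b} a≉b with s , sq , ¬sq ← shifted-nonsquare (a≉b ∘ sym ∘ x∙y⁻¹≈ε⇒x≈y b a) =
    s , sq , ¬sq ∘ square-resp (solve 3 (λ a b s → a :+ s :- b := s :- (b :- a)) refl a b s)

  two≉0 : IsUnit R (two R) → ¬ two R ≈ 0#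
  two≉0 unit-2 2≈0 = ¬unit-0 1≉0 (unit-resp 2≈0 unit-2)

  four≉0 : IsUnit R (two R) → ¬ two R * two R ≈ 0#
  four≉0 unit-2 4≈0 = two≉0 unit-2 (unit-cancel unit-2 4≈0)

  sqDiff-≉±1 : IsUnit R (two R) → ∀ {y} → ¬ y ≈ 1# → ¬ y ≈ - 1# → SqDiff R y
  sqDiff-≉±1 (h , 2h≈1) {y} y≉1 y≉-1 =
    A * A , B * B , square-of-unit (nonzero⇒unit A≉0) , square-of-unit (nonzero⇒unit B≉0) , difference-of-squares 2h≈1 y
    where
    A = (y + 1#) * h
    B = (y - 1#) * h

    unscale : ∀ {x} → x * h ≈ 0# → x ≈ 0#
    unscale {x} xh≈0 = begin
      x                ≈⟨ solve 2 (λ x h → x := x :* h :* con (+ 2) :+ x :* (con (+ 1) :- con (+ 2) :* h)) refl x h ⟩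
      x * h * two R + x * (1# - two R * h)  ≈⟨ +-cong (*-congʳ xh≈0) (*-congˡ (x≈y⇒x∙y⁻¹≈ε (sym 2h≈1))) ⟩
      0# * two R + x * 0#                  ≈⟨ solve 1 (λ x → con (+ 0) :* con (+ 2) :+ x :* con (+ 0) := con (+ 0)) refl x ⟩
      0#               ∎

    A≉0 : ¬ A ≈ 0#
    A≉0 = y≉-1 ∘ +-inverseˡ-unique _ _ ∘ unscale

    B≉0 : ¬ B ≈ 0#
    B≉0 = y≉1 ∘ x∙y⁻¹≈ε⇒x≈y y 1# ∘ unscale

  sqDiff₂-all-odd : IsUnit R (two R) → ∀ y → SqDiff₂ R y
  sqDiff₂-all-odd unit-2 y with y ≈? 1# | y ≈? (- 1#)
  ... | yes y≈1 | _ = sqDiff₂-resp (sym y≈1)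
    (two R + 1# , - 1# - 1# , sqDiff-≉±1 unit-2 3≉1 3≉-1 , (- 1# , 1# , sq-1 , square-1 , refl) ,
     solve 0 (con (+ 1) := con (+ 3) :+ (:- con (+ 1) :- con (+ 1))) refl)
    where
    3≉1 : ¬ two R + 1# ≈ 1#
    3≉1 3≈1 = two≉0 unit-2 (trans (solve 0 (con (+ 2) := con (+ 3) :- con (+ 1)) refl) (x≈y⇒x∙y⁻¹≈ε 3≈1))
    3≉-1 : ¬ two R + 1# ≈ - 1#
    3≉-1 3≈-1 = four≉0 unit-2 (trans (solve 0 (con (+ 2) :* con (+ 2) := con (+ 3) :- :- con (+ 1)) refl) (x≈y⇒x∙y⁻¹≈ε 3≈-1))
  ... | no _ | yes y≈-1 = sqDiff₂-resp (sym y≈-1)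
    (- (two R + 1#) , 1# - - 1# , sqDiff-≉±1 unit-2 -3≉1 -3≉-1 , (1# , - 1# , square-1 , sq-1 , refl) ,
     solve 0 (:- con (+ 1) := :- con (+ 3) :+ (con (+ 1) :- :- con (+ 1))) refl)
    where
    -3≉1 : ¬ - (two R + 1#) ≈ 1#
    -3≉1 -3≈1 =
      four≉0 unit-2 (trans (solve 0 (con (+ 2) :* con (+ 2) := con (+ 1) :- :- con (+ 3)) refl) (x≈y⇒x∙y⁻¹≈ε (sym -3≈1)))
    -3≉-1 : ¬ - (two R + 1#) ≈ - 1#
    -3≉-1 -3≈-1 = two≉0 unit-2 (trans (solve 0 (con (+ 2) := :- con (+ 1) :- :- con (+ 3)) refl) (x≈y⇒x∙y⁻¹≈ε (sym -3≈-1)))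
  ... | no y≉1 | no y≉-1 = sqDiff⇒sqDiff₂ (sqDiff-≉±1 unit-2 y≉1 y≉-1)

  -1≈1 : two R ≈ 0# → - 1# ≈ 1#
  -1≈1 2≈0 = begin
    - 1#              ≈⟨ solve 0 (:- con (+ 1) := con (+ 1) :- con (+ 2)) refl ⟩
    1# - two R        ≈⟨ +-congˡ (-‿cong 2≈0) ⟩
    1# - 0#           ≈⟨ solve 0 (con (+ 1) :- con (+ 0) := con (+ 1)) refl ⟩
    1#                ∎

  +1≉0 : two R ≈ 0# → ∀ {x} → ¬ x ≈ 1# → ¬ x + 1# ≈ 0#
  +1≉0 2≈0 x≉1 = x≉1 ∘ flip trans (-1≈1 2≈0) ∘ +-inverseˡ-unique _ _

  sqDiff-all-even : two R ≈ 0# → ∀ {b} → ¬ b ≈ 0# → ¬ b ≈ 1# → ∀ y → SqDiff R y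
  sqDiff-all-even 2≈0 {b} b≉0 b≉1 y with y ≈? 1#
  ... | yes y≈1 = b + 1# , b , nonzero⇒square 2≈0 (+1≉0 2≈0 b≉1) , nonzero⇒square 2≈0 b≉0 ,
                  trans y≈1 (solve 1 (λ b → con (+ 1) := b :+ con (+ 1) :- b) refl b)
  ... | no y≉1  = y + 1# , 1# , nonzero⇒square 2≈0 (+1≉0 2≈0 y≉1) , square-1 ,
                  solve 1 (λ y → y := y :+ con (+ 1) :- con (+ 1)) refl y

  sqDiff₂-all : ∀ {b} → ¬ b ≈ 0# → ¬ b ≈ 1# → ∀ y → SqDiff₂ R y
  sqDiff₂-all b≉0 b≉1 y with two R ≈? 0#
  ... | yes 2≈0 = sqDiff⇒sqDiff₂ (sqDiff-all-even 2≈0 b≉0 b≉1 y)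
  ... | no  2≉0 = sqDiff₂-all-odd (nonzero⇒unit 2≉0) y

  private
    zeroOrOne-resp : (λ y → y ≈ 0# ⊎ y ≈ 1#) Respects _≈_
    zeroOrOne-resp x≈y = Sum.map (trans (sym x≈y)) (trans (sym x≈y))

  zeroOrOne? : Dec (ZeroOrOne R)
  zeroOrOne? = all? zeroOrOne-resp (λ y → (y ≈? 0#) ⊎-dec (y ≈? 1#))

  ¬zeroOrOne⇒∃ : ¬ ZeroOrOne R → ∃ λ b → ¬ b ≈ 0# × ¬ b ≈ 1#
  ¬zeroOrOne⇒∃ ¬zeroOrOne = Σ.map id (λ ¬either → ¬either ∘ inj₁ , ¬either ∘ inj₂)
    (¬∀⇒∃¬ zeroOrOne-resp (λ y → (y ≈? 0#) ⊎-dec (y ≈? 1#)) ¬zeroOrOne)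

  module _ (zeroOrOne : ZeroOrOne R) where

    1+1≈0 : 1# + 1# ≈ 0#
    1+1≈0 with zeroOrOne (1# + 1#)
    ... | inj₁ 2≈0 = 2≈0
    ... | inj₂ 2≈1 = contradiction (trans (solve 0 (con (+ 1) := con (+ 2) :- con (+ 1)) refl) (x≈y⇒x∙y⁻¹≈ε 2≈1)) 1≉0

    zeroOrOne-flip : ∀ {x y} → ¬ x ≈ y → x + 1# ≈ y
    zeroOrOne-flip {x} {y} x≉y with zeroOrOne x | zeroOrOne y
    ... | inj₁ x≈0 | inj₁ y≈0 = contradiction (trans x≈0 (sym y≈0)) x≉y
    ... | inj₂ x≈1 | inj₂ y≈1 = contradiction (trans x≈1 (sym y≈1)) x≉y
    ... | inj₁ x≈0 | inj₂ y≈1 = trans (+-congʳ x≈0) (trans (+-identityˡ 1#) (sym y≈1))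
    ... | inj₂ x≈1 | inj₁ y≈0 = trans (+-congʳ x≈1) (trans 1+1≈0 (sym y≈0))

    private
      ⌜_⌝ : Bool → Carrier
      ⌜ false ⌝ = 0#
      ⌜ true  ⌝ = 1#

      toBool : Carrier → Bool
      toBool x = does (x ≈? 1#)

      toBool-⌜⌝ : ∀ b {x} → x ≈ ⌜ b ⌝ → toBool x ≡ b
      toBool-⌜⌝ false {x} x≈0 = dec-false (x ≈? 1#) (λ x≈1 → 1≉0 (trans (sym x≈1) x≈0))
      toBool-⌜⌝ true  {x} x≈1 = dec-true (x ≈? 1#) x≈1

      ⌜toBool⌝ : ∀ x → x ≈ ⌜ toBool x ⌝
      ⌜toBool⌝ x with zeroOrOne x
      ... | inj₁ x≈0 = ≡.subst (λ b → x ≈ ⌜ b ⌝) (≡.sym (toBool-⌜⌝ false x≈0)) x≈0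
      ... | inj₂ x≈1 = ≡.subst (λ b → x ≈ ⌜ b ⌝) (≡.sym (toBool-⌜⌝ true x≈1)) x≈1

      ⌜⌝-+ : ∀ a b → ⌜ a ⌝ + ⌜ b ⌝ ≈ ⌜ a xor b ⌝
      ⌜⌝-+ false b     = +-identityˡ _
      ⌜⌝-+ true  false = +-identityʳ 1#
      ⌜⌝-+ true  true  = 1+1≈0

      ⌜⌝-* : ∀ a b → ⌜ a ⌝ * ⌜ b ⌝ ≈ ⌜ a ∧ b ⌝
      ⌜⌝-* false b = zeroˡ _
      ⌜⌝-* true  b = *-identityˡ _

      ⌜⌝-neg : ∀ a → - ⌜ a ⌝ ≈ ⌜ a ⌝
      ⌜⌝-neg false = solve 0 (:- con (+ 0) := con (+ 0)) refl
      ⌜⌝-neg true  = sym (+-inverseˡ-unique _ _ 1+1≈0)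

      homo₂ : ∀ (_∙_ : Carrier → Carrier → Carrier) (_∘_ : Bool → Bool → Bool) →
              (∀ a b → ⌜ a ⌝ ∙ ⌜ b ⌝ ≈ ⌜ a ∘ b ⌝) → (∀ {x x′ y y′} → x ≈ x′ → y ≈ y′ → (x ∙ y) ≈ (x′ ∙ y′)) →
              ∀ x y → toBool (x ∙ y) ≡ toBool x ∘ toBool y
      homo₂ _∙_ _∘_ ⌜⌝-∙ ∙-cong x y =
        toBool-⌜⌝ _ (trans (∙-cong (⌜toBool⌝ x) (⌜toBool⌝ y)) (⌜⌝-∙ (toBool x) (toBool y)))

    zeroOrOne⇒≅𝔽₂ : R ≅ 𝔽₂
    zeroOrOne⇒≅𝔽₂ = toBool , record
      { isRingMonomorphism = record
        { isRingHomomorphism = record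
          { isSemiringHomomorphism = record
            { isNearSemiringHomomorphism = record
              { +-isMonoidHomomorphism = record
                { isMagmaHomomorphism = record
                  { isRelHomomorphism = record { cong = λ {x} {y} x≈y → toBool-⌜⌝ _ (trans x≈y (⌜toBool⌝ y)) }
                  ; homo = homo₂ _+_ _xor_ ⌜⌝-+ +-cong }
                ; ε-homo = toBool-⌜⌝ false refl }
              ; *-homo = homo₂ _*_ _∧_ ⌜⌝-* *-cong }
            ; 1#-homo = toBool-⌜⌝ true refl }
          ; -‿homo = λ x → toBool-⌜⌝ _ (trans (-‿cong (⌜toBool⌝ x)) (⌜⌝-neg (toBool x))) }
        ; injective = λ {x} {y} same → trans (⌜toBool⌝ x) (trans (reflexive (≡.cong ⌜_⌝ same)) (sym (⌜toBool⌝ y))) }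
      ; surjective = λ b → ⌜ b ⌝ , toBool-⌜⌝ b }

module Characteristic (R : Ring₀) (finite : IsFinite R) where
  open CommutativeRing R
  open import Relation.Binary.Reasoning.Setoid setoid
  open IntegerCoefficientSolver R
  open UnitsAndSquares R
  open FiniteRing R finite
  open FiniteSetoid setoid index index-sound using (pigeonhole)

  natMul-+ : ∀ m n → natMul R (m ℕ.+ n) ≈ natMul R m + natMul R n
  natMul-+ zero    n = sym (+-identityˡ _)
  natMul-+ (suc m) n = trans (+-congˡ (natMul-+ m n)) (sym (+-assoc _ _ _))

  natMul-vanishes : ∃ λ c → natMul R (suc c) ≈ 0#
  natMul-vanishes = vanishing-difference (pigeonhole (natMul R))
    where
    vanishing-difference : (∃₂ λ a c → natMul R a ≈ natMul R (a ℕ.+ suc c)) → ∃ λ c → natMul R (suc c) ≈ 0#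
    vanishing-difference (a , c , same) = c , (begin
      natMul R (suc c)                          ≈⟨ solve 2 (λ x y → y := x :+ y :- x) refl (natMul R a) (natMul R (suc c)) ⟩
      natMul R a + natMul R (suc c) - natMul R a ≈⟨ +-congʳ (trans (sym (natMul-+ a (suc c))) (sym same)) ⟩
      natMul R a - natMul R a                    ≈⟨ -‿inverseʳ _ ⟩
      0#                                         ∎)

  characteristic : ∃ λ ℓ → HasCharacteristic R ℓ
  characteristic =
    minimal (least (λ m → (0 ℕ.<? m) ×-dec (natMul R m ≈? 0#)) {suc (proj₁ natMul-vanishes)} (ℕ.z<s , proj₂ natMul-vanishes))
    where
    minimal : (∃ λ ℓ → (0 ℕ.< ℓ × natMul R ℓ ≈ 0#) × (∀ {m} → m ℕ.< ℓ → ¬ (0 ℕ.< m × natMul R m ≈ 0#))) →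
              ∃ λ ℓ → HasCharacteristic R ℓ
    minimal (ℓ , (0<ℓ , ℓ-vanishes) , below) = ℓ , 0<ℓ , ℓ-vanishes , λ m 0<m m<ℓ → below m<ℓ ∘ (0<m ,_)

  hasCharacteristic-2 : ¬ 1# ≈ 0# → two R ≈ 0# → HasCharacteristic R 2
  hasCharacteristic-2 1≉0 2≈0 = ℕ.z<s , trans (+-congˡ (+-identityʳ 1#)) 2≈0 , below
    where
    below : ∀ m → 0 ℕ.< m → m ℕ.< 2 → ¬ natMul R m ≈ 0#
    below 1 _ _ 1+0≈0 = 1≉0 (trans (sym (+-identityʳ 1#)) 1+0≈0)
    below (suc (suc _)) _ (ℕ.s≤s (ℕ.s≤s ()))

  characteristic≢2 : IsUnit R (two R) → ¬ 1# ≈ 0# → ∀ {ℓ} → HasCharacteristic R ℓ → ℓ ≢ 2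
  characteristic≢2 unit-2 1≉0 (_ , 2≈0 , _) ≡.refl =
    ¬unit-0 1≉0 (unit-resp (trans (+-congˡ (sym (+-identityʳ 1#))) 2≈0) unit-2)

module _ (S : Ring₀) (iso : S ≅ 𝔽₂) where
  open CommutativeRing S
  private
    f = proj₁ iso
    module f = RingMorphisms.IsRingIsomorphism (proj₂ iso)

  𝔽₂-unit : ∀ {u} → IsUnit S u → f u ≡ true
  𝔽₂-unit {u} (v , uv≈1) with f u in fu
  ... | true  = ≡.refl
  ... | false = ≡.trans (≡.sym (≡.cong (_∧ f v) fu)) (≡.trans (≡.sym (f.*-homo u v)) (≡.trans (f.⟦⟧-cong uv≈1) f.1#-homo))

  𝔽₂-adjacent : ∀ {a b} → SqUnit S (a - b) → f a ≡ not (f b)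
  𝔽₂-adjacent {a} {b} sq = xor≡true (≡.trans (≡.sym f-sub) (𝔽₂-unit (UnitsAndSquares.square⇒unit S sq)))
    where
    f-sub : f (a - b) ≡ f a xor f b
    f-sub = ≡.trans (f.+-homo a (- b)) (≡.cong (f a xor_) (f.-‿homo b))
    xor≡true : ∀ {x y} → x xor y ≡ true → x ≡ not y
    xor≡true {true}  {false} _ = ≡.refl
    xor≡true {false} {true}  _ = ≡.refl
    xor≡true {true}  {true}  ()
    xor≡true {false} {false} ()

  𝔽₂-0≉1 : ¬ 0# ≈ 1#
  𝔽₂-0≉1 0≈1 with () ← ≡.trans (≡.sym f.0#-homo) (≡.trans (f.⟦⟧-cong 0≈1) f.1#-homo)

module Product {n : ℕ} (R : Fin (suc (suc n)) → Ring₀) (finite : ∀ i → IsFinite (R i)) where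
  private
    module Rᵢ (i : Fin (suc (suc n))) = CommutativeRing (R i)
    module Π = CommutativeRing (ΠRing R)
    module Fᵢ (i : Fin (suc (suc n))) = FiniteRing (R i) (finite i)
    module Sᵢ (i : Fin (suc (suc n))) = UnitsAndSquares (R i)
    module SΠ = UnitsAndSquares (ΠRing R)

    x-0≈x : ∀ k x → Rᵢ._≈_ k (Rᵢ._-_ k x (Rᵢ.0# k)) x
    x-0≈x k x = Rᵢ.trans k (Rᵢ.+-congˡ k (RingProperties.-0#≈0# (Rᵢ.ring k))) (Rᵢ.+-identityʳ k x)

  sqUnit-Π⁺ : ∀ {x} → (∀ k → SqUnit (R k) (x k)) → SqUnit (ΠRing R) x
  sqUnit-Π⁺ sq = (λ k → proj₁ (sq k)) , ((λ k → proj₁ (proj₁ (proj₂ (sq k)))) , λ k → proj₂ (proj₁ (proj₂ (sq k)))) ,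
                 λ k → proj₂ (proj₂ (sq k))

  sqUnit-Π⁻ : ∀ {x} → SqUnit (ΠRing R) x → ∀ k → SqUnit (R k) (x k)
  sqUnit-Π⁻ (u , (v , uv≈1) , x≈uu) k = u k , (v k , uv≈1 k) , x≈uu k

  adjacent? : ∀ v x → Dec (Adj (ΠRing R) v x)
  adjacent? v x = map′ sqUnit-Π⁺ sqUnit-Π⁻ (Fin.all? (λ k → Fᵢ.square? k _))

  _≈Π?_ : ∀ x y → Dec (x Π.≈ y)
  x ≈Π? y = Fin.all? (λ k → Fᵢ._≈?_ k (x k) (y k))

  _[_]≔_ : Π.Carrier → (i : Fin (suc (suc n))) → Rᵢ.Carrier i → Π.Carrier
  (x [ i ]≔ a) k with k Fin.≟ i
  ... | yes ≡.refl = a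
  ... | no  _      = x k

  []≔-lookup : ∀ x i a → (x [ i ]≔ a) i ≡ a
  []≔-lookup x i a with i Fin.≟ i
  ... | yes ≡.refl = ≡.refl
  ... | no  i≢i    = contradiction ≡.refl i≢i

  []≔-other : ∀ x {i k a} → k ≢ i → (x [ i ]≔ a) k ≡ x k
  []≔-other x {i} {k} k≢i with k Fin.≟ i
  ... | yes k≡i = contradiction k≡i k≢i
  ... | no  _   = ≡.refl

  []≔-cases : ∀ (P : ∀ k → Rᵢ.Carrier k → Set) {x i a} → P i a → (∀ k → k ≢ i → P k (x k)) →
               ∀ k → P k ((x [ i ]≔ a) k)
  []≔-cases P {i = i} pa px k with k Fin.≟ i
  ... | yes ≡.refl = pa
  ... | no  k≢i    = px k k≢i

  infix 4 _∈ᵥ_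
  _∈ᵥ_ : Π.Carrier → Subset (ΠRing R) → Set
  x ∈ᵥ X = _∈ₛ_ (ΠRing R) x X

  subset : (Q : Π.Carrier → Set) → Q Respects Π._≈_ → U.Decidable Q → Subset (ΠRing R)
  subset Q Q-resp Q? = (λ x → does (Q? x)) ,
    λ x≈y → does-⇔ (mk⇔ (Q-resp x≈y) (Q-resp (Π.sym x≈y))) (Q? _) (Q? _)

  adjacent-respʳ : ∀ {v x y} → x Π.≈ y → Adj (ΠRing R) v x → Adj (ΠRing R) v y
  adjacent-respʳ x≈y = SΠ.square-resp (Π.+-congˡ (Π.-‿cong x≈y))

  ¬prime-𝔽₂×𝔽₂ : ∀ {i j} → i ≢ j → R i ≅ 𝔽₂ → R j ≅ 𝔽₂ → ¬ IsPrimeGraph (ΠRing R)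
  ¬prime-𝔽₂×𝔽₂ {i} {j} i≢j f g prime = prime X homogeneous ((Π.0# , Π.1# , 0∈X , 1∈X , 0≉1) , (eᵢ , eᵢ∉X))
    where
    module f = RingMorphisms.IsRingIsomorphism (proj₂ f)
    module g = RingMorphisms.IsRingIsomorphism (proj₂ g)

    Balanced : Π.Carrier → Set
    Balanced x = proj₁ f (x i) ≡ proj₁ g (x j)

    balanced? : U.Decidable Balanced
    balanced? x = proj₁ f (x i) Bool.≟ proj₁ g (x j)

    X : Subset (ΠRing R)
    X = subset Balanced (λ x≈y eq → ≡.trans (≡.sym (f.⟦⟧-cong (x≈y i))) (≡.trans eq (g.⟦⟧-cong (x≈y j)))) balanced?

    homogeneous : IsHomogeneous (ΠRing R) X
    homogeneous v v∉X = inj₂ λ x x∈X adj → v∉X (dec-true (balanced? v) (begin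
      proj₁ f (v i)        ≡⟨ 𝔽₂-adjacent (R i) f (sqUnit-Π⁻ adj i) ⟩
      not (proj₁ f (x i))  ≡⟨ ≡.cong not (does-true (balanced? x) x∈X) ⟩
      not (proj₁ g (x j))  ≡⟨ 𝔽₂-adjacent (R j) g (sqUnit-Π⁻ adj j) ⟨
      proj₁ g (v j)        ∎))
      where open ≡.≡-Reasoning

    0∈X : Π.0# ∈ᵥ X
    0∈X = dec-true (balanced? Π.0#) (≡.trans f.0#-homo (≡.sym g.0#-homo))

    1∈X : Π.1# ∈ᵥ X
    1∈X = dec-true (balanced? Π.1#) (≡.trans f.1#-homo (≡.sym g.1#-homo))

    0≉1 : ¬ Π.0# Π.≈ Π.1#
    0≉1 0≈1 = 𝔽₂-0≉1 (R i) f (0≈1 i)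

    eᵢ : Π.Carrier
    eᵢ = Π.0# [ i ]≔ Rᵢ.1# i

    eᵢ∉X : ¬ eᵢ ∈ᵥ X
    eᵢ∉X eᵢ∈X = true≢false (begin
      true                 ≡⟨ f.1#-homo ⟨
      proj₁ f (Rᵢ.1# i)    ≡⟨ ≡.cong (proj₁ f) ([]≔-lookup Π.0# i (Rᵢ.1# i)) ⟨
      proj₁ f (eᵢ i)       ≡⟨ does-true (balanced? eᵢ) eᵢ∈X ⟩
      proj₁ g (eᵢ j)       ≡⟨ ≡.cong (proj₁ g) ([]≔-other Π.0# (i≢j ∘ ≡.sym)) ⟩
      proj₁ g (Rᵢ.0# j)    ≡⟨ g.0#-homo ⟩
      false                ∎)
      where
      open ≡.≡-Reasoning
      true≢false : true ≢ false
      true≢false ()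

  ¬prime-component : ∀ i {C : Rᵢ.Carrier i → Set} → C Respects Rᵢ._≈_ i → U.Decidable C → C (Rᵢ.0# i) →
                     (∀ {a b} → C a → SqUnit (R i) (Rᵢ._-_ i b a) → C b) →
                     ∀ {y} → ¬ C y → ¬ IsPrimeGraph (ΠRing R)
  ¬prime-component i {C} C-resp C? C0 C-step {y} ¬Cy prime =
    prime X homogeneous ((Π.0# , Π.1# , dec-true (C? _) C0 , dec-true (C? _) C1 , 0≉1) , (eᵢ , eᵢ∉X))
    where
    module Rᵢ′ = CommutativeRing (R i)

    X : Subset (ΠRing R)
    X = subset (λ x → C (x i)) (λ x≈y → C-resp (x≈y i)) (λ x → C? (x i))

    homogeneous : IsHomogeneous (ΠRing R) X
    homogeneous v v∉X = inj₂ λ x x∈X adj → v∉X (dec-true (C? (v i)) (C-step (does-true (C? (x i)) x∈X) (sqUnit-Π⁻ adj i)))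

    C1 : C Rᵢ′.1#
    C1 = C-step C0 (Sᵢ.square-resp i (Rᵢ′.sym (x-0≈x i Rᵢ′.1#)) (Sᵢ.square-1 i))

    0≉1 : ¬ Π.0# Π.≈ Π.1#
    0≉1 0≈1 = ¬Cy (C-resp (Rᵢ′.sym y≈0) C0)
      where
      y≈0 : y Rᵢ′.≈ Rᵢ′.0#
      y≈0 = Rᵢ′.trans (Rᵢ′.sym (Rᵢ′.*-identityʳ y)) (Rᵢ′.trans (Rᵢ′.*-congˡ (Rᵢ′.sym (0≈1 i))) (Rᵢ′.zeroʳ y))

    eᵢ : Π.Carrier
    eᵢ = Π.0# [ i ]≔ y

    eᵢ∉X : ¬ eᵢ ∈ᵥ X
    eᵢ∉X = ¬Cy ∘ ≡.subst C ([]≔-lookup Π.0# i y) ∘ does-true (C? (eᵢ i))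

  other : Fin (suc (suc n)) → Fin (suc (suc n))
  other Fin.zero    = Fin.suc Fin.zero
  other (Fin.suc _) = Fin.zero

  other-≢ : ∀ i → other i ≢ i
  other-≢ Fin.zero    ()
  other-≢ (Fin.suc _) ()

  ¬prime-twins : (∀ k → ¬ Rᵢ._≈_ k (Rᵢ.1# k) (Rᵢ.0# k)) →
                 ∀ i {a} → ¬ Rᵢ._≈_ i a (Rᵢ.0# i) →
                 (∀ {s} → SqUnit (R i) s → SqUnit (R i) (Rᵢ._-_ i s a)) →
                 (∀ {s} → SqUnit (R i) (Rᵢ._-_ i s a) → SqUnit (R i) s) →
                 ¬ IsPrimeGraph (ΠRing R)
  ¬prime-twins 1≉0 i {a} a≉0 shift unshift prime =
    prime X homogeneous ((Π.0# , e , dec-true (twin? Π.0#) (inj₁ Π.refl) , dec-true (twin? e) (inj₂ Π.refl) , 0≉e) ,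
                         (Π.1# , 1∉X))
    where
    module Rᵢ′ = CommutativeRing (R i)

    e : Π.Carrier
    e = Π.0# [ i ]≔ a

    Twin : Π.Carrier → Set
    Twin x = x Π.≈ Π.0# ⊎ x Π.≈ e

    twin? : U.Decidable Twin
    twin? x = (x ≈Π? Π.0#) ⊎-dec (x ≈Π? e)

    X : Subset (ΠRing R)
    X = subset Twin (λ x≈y → Sum.map (Π.trans (Π.sym x≈y)) (Π.trans (Π.sym x≈y))) twin?

    adj-0⇒adj-e : ∀ {v} → Adj (ΠRing R) v Π.0# → Adj (ΠRing R) v e
    adj-0⇒adj-e {v} adj = sqUnit-Π⁺ ([]≔-cases (λ k t → SqUnit (R k) (Rᵢ._-_ k (v k) t))
      (shift (Sᵢ.square-resp i (x-0≈x i (v i)) (sqUnit-Π⁻ adj i))) (λ k _ → sqUnit-Π⁻ adj k))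

    adj-e⇒adj-0 : ∀ {v} → Adj (ΠRing R) v e → Adj (ΠRing R) v Π.0#
    adj-e⇒adj-0 {v} adj = sqUnit-Π⁺ λ k →
      []≔-cases (λ k t → SqUnit (R k) (Rᵢ._-_ k (v k) t) → SqUnit (R k) (Rᵢ._-_ k (v k) (Rᵢ.0# k)))
        (Sᵢ.square-resp i (Rᵢ′.sym (x-0≈x i (v i))) ∘ unshift) (λ _ _ → id) k (sqUnit-Π⁻ adj k)

    homogeneous : IsHomogeneous (ΠRing R) X
    homogeneous v _ = by-cases (adjacent? v Π.0#)
      where
      by-cases : Dec (Adj (ΠRing R) v Π.0#) →
                 (∀ x → x ∈ᵥ X → Adj (ΠRing R) v x) ⊎ (∀ x → x ∈ᵥ X → ¬ Adj (ΠRing R) v x)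
      by-cases (yes adj) = inj₁ λ x x∈X →
        Sum.[ (λ x≈0 → adjacent-respʳ (Π.sym x≈0) adj) , (λ x≈e → adjacent-respʳ (Π.sym x≈e) (adj-0⇒adj-e adj)) ]
          (does-true (twin? x) x∈X)
      by-cases (no ¬adj) = inj₂ λ x x∈X adj → ¬adj
        (Sum.[ (λ x≈0 → adjacent-respʳ x≈0 adj) , (λ x≈e → adj-e⇒adj-0 (adjacent-respʳ x≈e adj)) ]
          (does-true (twin? x) x∈X))

    0≉e : ¬ Π.0# Π.≈ e
    0≉e 0≈e = a≉0 (Rᵢ′.sym (≡.subst (Rᵢ′._≈_ Rᵢ′.0#) ([]≔-lookup Π.0# i a) (0≈e i)))

    1∉X : ¬ Π.1# ∈ᵥ X
    1∉X 1∈X = Sum.[ (λ 1≈0 → 1≉0 i (1≈0 i)) ,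
                    (λ 1≈e → 1≉0 (other i) (≡.subst (Rᵢ._≈_ (other i) _) ([]≔-other Π.0# (other-≢ i)) (1≈e (other i)))) ]
                  (does-true (twin? Π.1#) 1∈X)

  module Primality (isField : ∀ i → IsField (R i)) (sq-1 : ∀ i → SqUnit (R i) (Rᵢ.-_ i (Rᵢ.1# i)))
                   (zeroOrOne-unique : ∀ i j → ZeroOrOne (R i) → ZeroOrOne (R j) → i ≡ j) where
    private
      module Kᵢ (i : Fin (suc (suc n))) = FiniteField (R i) (finite i) (isField i) (sq-1 i)
      module Pᵢ (i : Fin (suc (suc n))) = RingProperties (Rᵢ.ring i)

    adjacent-sym : ∀ {v x} → Adj (ΠRing R) v x → Adj (ΠRing R) x v
    adjacent-sym {v} {x} adj = sqUnit-Π⁺ λ k →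
      Sᵢ.square-resp k (Pᵢ.⁻¹-anti-homo‿- k (v k) (x k)) (Sᵢ.square-neg k (sq-1 k) (sqUnit-Π⁻ adj k))

    adjacent-+ : ∀ {x t} → SqUnit (ΠRing R) t → Adj (ΠRing R) (x Π.+ t) x
    adjacent-+ {x} {t} sq = sqUnit-Π⁺ λ k → Sᵢ.square-resp k (Rᵢ.sym k (Pᵢ.xyx⁻¹≈y k (x k) (t k))) (sqUnit-Π⁻ sq k)

    ¬adjacent-≈ : ∀ k {v x} → Rᵢ._≈_ k (v k) (x k) → ¬ Adj (ΠRing R) v x
    ¬adjacent-≈ k v≈x adj = Sᵢ.¬square-0 k (Kᵢ.1≉0 k) (Sᵢ.square-resp k (Pᵢ.x≈y⇒x∙y⁻¹≈ε k v≈x) (sqUnit-Π⁻ adj k))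

    module _ (X : Subset (ΠRing R)) (homogeneous : IsHomogeneous (ΠRing R) X) where

      split : ∀ {x y w} → x ∈ᵥ X → y ∈ᵥ X → Adj (ΠRing R) w x → ¬ Adj (ΠRing R) w y → w ∈ᵥ X
      split {x} {y} {w} x∈X y∈X wx ¬wy = decidable-stable (proj₁ X w Bool.≟ true) λ w∉X →
        Sum.[ (λ all → ¬wy (all y y∈X)) , (λ none → none x x∈X wx) ] (homogeneous w w∉X)

      closed : ∀ {x y w} → x ∈ᵥ X → y ∈ᵥ X → Adj (ΠRing R) y x → Adj (ΠRing R) w x → w ∈ᵥ X
      closed {x} {y} {w} x∈X y∈X yx wx = split x∈X (split x∈X y∈X zx (¬adjacent-≈ Fin.zero (Rᵢ.refl Fin.zero))) wx
                                                (¬adjacent-≈ (Fin.suc Fin.zero) (Rᵢ.refl (Fin.suc Fin.zero)))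
        where
        -- z agrees with y in coordinate 0 and with w in coordinate 1: it separates x from y, and w from z.
        z : Π.Carrier
        z Fin.zero             = y Fin.zero
        z (Fin.suc Fin.zero)   = w (Fin.suc Fin.zero)
        z (Fin.suc (Fin.suc k)) = Rᵢ._+_ _ (x (Fin.suc (Fin.suc k))) (Rᵢ.1# _)
        zx : Adj (ΠRing R) z x
        zx = sqUnit-Π⁺ λ where
          Fin.zero              → sqUnit-Π⁻ yx Fin.zero
          (Fin.suc Fin.zero)    → sqUnit-Π⁻ wx (Fin.suc Fin.zero)
          (Fin.suc (Fin.suc k)) → Sᵢ.square-resp _ (Rᵢ.sym _ (Pᵢ.xyx⁻¹≈y _ (x _) _)) (Sᵢ.square-1 _)

      Anchored : Π.Carrier → Set
      Anchored x = x ∈ᵥ X × ∃ λ y → y ∈ᵥ X × Adj (ΠRing R) y x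

      anchored-step : ∀ {x w} → Anchored x → Adj (ΠRing R) w x → Anchored w
      anchored-step {x} (x∈X , y , y∈X , yx) wx = closed x∈X y∈X yx wx , x , x∈X , adjacent-sym wx

      anchored-resp : ∀ {x x′} → x Π.≈ x′ → Anchored x → Anchored x′
      anchored-resp x≈x′ (x∈X , y , y∈X , yx) = ≡.trans (≡.sym (proj₂ X x≈x′)) x∈X , y , y∈X , adjacent-respʳ x≈x′ yx

      anchored-+sqDiff : ∀ {x δ} → Anchored x → (∀ k → SqDiff (R k) (δ k)) → Anchored (x Π.+ δ)
      anchored-+sqDiff {x} {δ} anchored sqDiff =
        anchored-step (anchored-resp x+s≈x+δ+s′ (anchored-step anchored (adjacent-+ (sqUnit-Π⁺ sq))))
                      (adjacent-sym (adjacent-+ (sqUnit-Π⁺ sq′)))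
        where
        s s′ : Π.Carrier
        s  k = proj₁ (sqDiff k)
        s′ k = proj₁ (proj₂ (sqDiff k))
        sq : ∀ k → SqUnit (R k) (s k)
        sq k = proj₁ (proj₂ (proj₂ (sqDiff k)))
        sq′ : ∀ k → SqUnit (R k) (s′ k)
        sq′ k = proj₁ (proj₂ (proj₂ (proj₂ (sqDiff k))))
        x+s≈x+δ+s′ : (x Π.+ s) Π.≈ (x Π.+ δ Π.+ s′)
        x+s≈x+δ+s′ k = begin
          x k + s k                 ≈⟨ +-congˡ (//-rightDividesˡ (s′ k) (s k)) ⟨
          x k + (s k - s′ k + s′ k) ≈⟨ +-congˡ (+-congʳ (proj₂ (proj₂ (proj₂ (proj₂ (sqDiff k)))))) ⟨
          x k + (δ k + s′ k)        ≈⟨ +-assoc _ _ _ ⟨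
          x k + δ k + s′ k          ∎
          where
          open CommutativeRing (R k)
          open RingProperties ring using (//-rightDividesˡ)
          open import Relation.Binary.Reasoning.Setoid setoid

      anchored-+sqDiff₂ : ∀ {x δ} → Anchored x → (∀ k → SqDiff₂ (R k) (δ k)) → Anchored (x Π.+ δ)
      anchored-+sqDiff₂ {x} {δ} anchored sqDiff₂ =
        anchored-resp x+p+q≈x+δ (anchored-+sqDiff (anchored-+sqDiff anchored (proj₁ ∘ parts)) (proj₂ ∘ parts))
        where
        parts : ∀ k → SqDiff (R k) (proj₁ (sqDiff₂ k)) × SqDiff (R k) (proj₁ (proj₂ (sqDiff₂ k)))
        parts k = proj₁ (proj₂ (proj₂ (sqDiff₂ k))) , proj₁ (proj₂ (proj₂ (proj₂ (sqDiff₂ k))))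
        x+p+q≈x+δ : (x Π.+ (λ k → proj₁ (sqDiff₂ k)) Π.+ (λ k → proj₁ (proj₂ (sqDiff₂ k)))) Π.≈ (x Π.+ δ)
        x+p+q≈x+δ k = Rᵢ.trans k (Rᵢ.+-assoc k _ _ _) (Rᵢ.+-congˡ k (Rᵢ.sym k (proj₂ (proj₂ (proj₂ (proj₂ (sqDiff₂ k)))))))

      anchored-exists : ∀ {a b} → a ∈ᵥ X → b ∈ᵥ X → ¬ a Π.≈ b → Anchored a
      anchored-exists {a} {b} a∈X b∈X a≉b = separate (Fin.¬∀⟶∃¬ _ _ (λ k → Fᵢ._≈?_ k (a k) (b k)) a≉b)
        where
        separate : (∃ λ j → ¬ Rᵢ._≈_ j (a j) (b j)) → Anchored a
        separate (j , aⱼ≉bⱼ) = neighbour (Kᵢ.separating-square j aⱼ≉bⱼ)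
          where
          neighbour : (∃ λ s → SqUnit (R j) s × ¬ SqUnit (R j) (Rᵢ._-_ j (Rᵢ._+_ j (a j) s) (b j))) → Anchored a
          neighbour (s , sq , ¬sq) = a∈X , a Π.+ t , split a∈X b∈X wa ¬wb , wa
            where
            t : Π.Carrier
            t = Π.1# [ j ]≔ s
            wa : Adj (ΠRing R) (a Π.+ t) a
            wa = adjacent-+ (sqUnit-Π⁺ ([]≔-cases (λ k → SqUnit (R k)) sq (λ k _ → Sᵢ.square-1 k)))
            ¬wb : ¬ Adj (ΠRing R) (a Π.+ t) b
            ¬wb adj = ¬sq (≡.subst (λ tⱼ → SqUnit (R j) (Rᵢ._-_ j (Rᵢ._+_ j (a j) tⱼ) (b j)))
                                   ([]≔-lookup Π.1# j s) (sqUnit-Π⁻ adj j))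

      anchored-agreeing : ∀ {a} (v : Π.Carrier) → Anchored a →
                          ∃ λ a′ → Anchored a′ × (∀ k → ZeroOrOne (R k) → Rᵢ._≈_ k (a′ k) (v k))
      anchored-agreeing {a} v anchored =
        by-cases (Fin.any? (λ k → Kᵢ.zeroOrOne? k ×-dec ¬? (Fᵢ._≈?_ k (a k) (v k))))
        where
        by-cases : Dec (∃ λ k → ZeroOrOne (R k) × ¬ Rᵢ._≈_ k (a k) (v k)) →
                   ∃ λ a′ → Anchored a′ × (∀ k → ZeroOrOne (R k) → Rᵢ._≈_ k (a′ k) (v k))
        -- Every edge flips the (unique) 𝔽₂-coordinate; a step along the all-ones vector fixes it.
        by-cases (yes (k₀ , zeroOrOne₀ , a≉v)) =
          a Π.+ Π.1# , anchored-step anchored (adjacent-+ SΠ.square-1) , flipped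
          where
          flipped : ∀ k → ZeroOrOne (R k) → Rᵢ._≈_ k (Rᵢ._+_ k (a k) (Rᵢ.1# k)) (v k)
          flipped k zeroOrOne with ≡.refl ← zeroOrOne-unique k k₀ zeroOrOne zeroOrOne₀ = Kᵢ.zeroOrOne-flip k zeroOrOne a≉v
        by-cases (no none) =
          a , anchored , λ k zeroOrOne → decidable-stable (Fᵢ._≈?_ k (a k) (v k)) (λ a≉v → none (k , zeroOrOne , a≉v))

      anchored-everywhere : ∀ {a} (v : Π.Carrier) → Anchored a → Anchored v
      anchored-everywhere v anchored = translate (anchored-agreeing v anchored)
        where
        translate : (∃ λ a′ → Anchored a′ × (∀ k → ZeroOrOne (R k) → Rᵢ._≈_ k (a′ k) (v k))) → Anchored v
        translate (a′ , anchored′ , agree) =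
          anchored-resp (λ k → Pᵢ.\\-leftDividesˡ k (a′ k) (v k)) (anchored-+sqDiff₂ anchored′ δ-sqDiff₂)
          where
          δ-sqDiff₂ : ∀ k → SqDiff₂ (R k) (Rᵢ._+_ k (Rᵢ.-_ k (a′ k)) (v k))
          δ-sqDiff₂ k with Kᵢ.zeroOrOne? k
          ... | yes zeroOrOne = Sᵢ.sqDiff₂-resp k
                  (Rᵢ.trans k (Rᵢ.sym k (Rᵢ.-‿inverseˡ k (v k))) (Rᵢ.+-congʳ k (Rᵢ.-‿cong k (Rᵢ.sym k (agree k zeroOrOne)))))
                  (Sᵢ.sqDiff⇒sqDiff₂ k (Sᵢ.sqDiff-0 k))
          ... | no ¬zeroOrOne with b , b≉0 , b≉1 ← Kᵢ.¬zeroOrOne⇒∃ k ¬zeroOrOne = Kᵢ.sqDiff₂-all k b≉0 b≉1 _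

    isPrime : IsPrimeGraph (ΠRing R)
    isPrime X homogeneous ((a , b , a∈X , b∈X , a≉b) , (v , v∉X)) =
      v∉X (proj₁ (anchored-everywhere X homogeneous v (anchored-exists X homogeneous a∈X b∈X a≉b)))

module PrimeCharacterisation {n : ℕ} (R : Fin (suc (suc n)) → Ring₀)
            (finite : ∀ i → IsFinite (R i)) (local : ∀ i → IsLocal (R i))
            (sq-1 : SqUnit (ΠRing R) (CommutativeRing.-_ (ΠRing R) (CommutativeRing.1# (ΠRing R)))) where
  open Product R finite
  private
    module Rᵢ (i : Fin (suc (suc n))) = CommutativeRing (R i)
    module Fᵢ (i : Fin (suc (suc n))) = FiniteRing (R i) (finite i)
    module Lᵢ (i : Fin (suc (suc n))) = FiniteLocalRing (R i) (finite i) (local i)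
    module Cᵢ (i : Fin (suc (suc n))) = Characteristic (R i) (finite i)

  sq-1ᵢ : ∀ i → SqUnit (R i) (Rᵢ.-_ i (Rᵢ.1# i))
  sq-1ᵢ = sqUnit-Π⁻ sq-1

  nonfield⇒¬prime : ∀ i {x} → ¬ IsUnit (R i) x → ¬ Rᵢ._≈_ i x (Rᵢ.0# i) → ¬ IsPrimeGraph (ΠRing R)
  nonfield⇒¬prime i {x} ¬unit x≉0 = by-parity (Fᵢ.unit? i (two (R i)))
    where
    by-parity : Dec (IsUnit (R i) (two (R i))) → ¬ IsPrimeGraph (ΠRing R)
    by-parity (yes unit-2) = twins (Lᵢ.nilsquare i ¬unit x≉0)
      where
      twins : (∃ λ a → ¬ Rᵢ._≈_ i a (Rᵢ.0# i) × Rᵢ._≈_ i (Rᵢ._*_ i a a) (Rᵢ.0# i)) → ¬ IsPrimeGraph (ΠRing R)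
      twins (a , a≉0 , aa≈0) = ¬prime-twins Lᵢ.1≉0 i a≉0 (UnitsAndSquares.square-sub-nilsquare (R i) unit-2 aa≈0)
                                                         (UnitsAndSquares.square-add-nilsquare (R i) unit-2 aa≈0)
    by-parity (no ¬unit-2) = component (Fᵢ.¬∀⇒∃¬ i squareMod₂-resp squareMod₂? (¬all-squareMod₂ (sq-1ᵢ i) ¬unit x≉0))
      where
      open CongruenceModTwo (R i)
      open EvenFiniteLocalRing (R i) (finite i) (local i) ¬unit-2
      component : (∃ λ y → ¬ SquareMod₂ y) → ¬ IsPrimeGraph (ΠRing R)
      component (y , ¬Cy) = ¬prime-component i squareMod₂-resp squareMod₂? squareMod₂-0 squareMod₂-+square ¬Cy

  prime⇒field : IsPrimeGraph (ΠRing R) → ∀ i → IsField (R i)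
  prime⇒field prime i = Lᵢ.1≉0 i , λ x x≉0 → decidable-stable (Fᵢ.unit? i x) (λ ¬unit → nonfield⇒¬prime i ¬unit x≉0 prime)

  Conditions : Set
  Conditions = (∀ i j → R i ≅ 𝔽₂ → R j ≅ 𝔽₂ → i ≡ j) ×
               (∀ i → ¬ IsUnit (R i) (two (R i)) → IsField (R i) × HasCharacteristic (R i) 2) ×
               (∀ i → IsUnit (R i) (two (R i)) → IsField (R i) × ∃ λ ℓ → HasCharacteristic (R i) ℓ × ℓ ≢ 2)

  prime⇒conditions : IsPrimeGraph (ΠRing R) → Conditions
  prime⇒conditions prime = at-most-one-𝔽₂ , characteristic-2 , odd-characteristic
    where
    at-most-one-𝔽₂ : ∀ i j → R i ≅ 𝔽₂ → R j ≅ 𝔽₂ → i ≡ j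
    at-most-one-𝔽₂ i j f g = decidable-stable (i Fin.≟ j) (λ i≢j → ¬prime-𝔽₂×𝔽₂ i≢j f g prime)

    characteristic-2 : ∀ i → ¬ IsUnit (R i) (two (R i)) → IsField (R i) × HasCharacteristic (R i) 2
    characteristic-2 i ¬unit-2 = prime⇒field prime i , Cᵢ.hasCharacteristic-2 i (Lᵢ.1≉0 i)
      (decidable-stable (Fᵢ._≈?_ i (two (R i)) (Rᵢ.0# i)) (¬unit-2 ∘ proj₂ (prime⇒field prime i) _))

    odd-characteristic : ∀ i → IsUnit (R i) (two (R i)) → IsField (R i) × ∃ λ ℓ → HasCharacteristic (R i) ℓ × ℓ ≢ 2
    odd-characteristic i unit-2 =
      prime⇒field prime i , Σ.map id (λ char-ℓ → char-ℓ , Cᵢ.characteristic≢2 i unit-2 (Lᵢ.1≉0 i) char-ℓ) (Cᵢ.characteristic i)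

  conditions⇒prime : Conditions → IsPrimeGraph (ΠRing R)
  conditions⇒prime (at-most-one-𝔽₂ , characteristic-2 , odd-characteristic) =
    Primality.isPrime isField sq-1ᵢ zeroOrOne-unique
    where
    isField : ∀ i → IsField (R i)
    isField i = by-parity (Fᵢ.unit? i (two (R i)))
      where
      by-parity : Dec (IsUnit (R i) (two (R i))) → IsField (R i)
      by-parity (yes unit-2) = proj₁ (odd-characteristic i unit-2)
      by-parity (no ¬unit-2) = proj₁ (characteristic-2 i ¬unit-2)

    zeroOrOne-unique : ∀ i j → ZeroOrOne (R i) → ZeroOrOne (R j) → i ≡ j
    zeroOrOne-unique i j zeroOrOne-i zeroOrOne-j = at-most-one-𝔽₂ i j
      (FiniteField.zeroOrOne⇒≅𝔽₂ (R i) (finite i) (isField i) (sq-1ᵢ i) zeroOrOne-i)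
      (FiniteField.zeroOrOne⇒≅𝔽₂ (R j) (finite j) (isField j) (sq-1ᵢ j) zeroOrOne-j)

theorem5p8 : (d : ℕ) → 2 ≤ d → (R : Fin d → CommutativeRing 0ℓ 0ℓ) →
    (∀ i → IsFinite (R i)) → (∀ i → IsLocal (R i)) →
    SqUnit (ΠRing R) (CommutativeRing.-_ (ΠRing R) (CommutativeRing.1# (ΠRing R))) →
    IsPrimeGraph (ΠRing R) ⇔
      ((∀ i j → R i ≅ 𝔽₂ → R j ≅ 𝔽₂ → i ≡ j) ×
       (∀ i → ¬ IsUnit (R i) (two (R i)) →
          IsField (R i) × HasCharacteristic (R i) 2) ×
       (∀ i → IsUnit (R i) (two (R i)) →
          IsField (R i) × ∃ λ ℓ → HasCharacteristic (R i) ℓ × ℓ ≢ 2))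
theorem5p8 (suc (suc n)) (ℕ.s≤s (ℕ.s≤s ℕ.z≤n)) R finite local sq-1 = mk⇔ prime⇒conditions conditions⇒prime
  where open PrimeCharacterisation R finite local sq-1
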